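{- Let $K$ be a field of characteristic $0$ and let $a,b,c\in K$. Let $$g(x)=\frac{1+ax}{1+bx+cx^2}=\sum_{n\ge 0} g_n x^n\in K[[x]],$$ let $g_e(x)=\sum_{n\ge0} g_n \frac{x^n}{n!}$, write $\frac{1}{g_e(x)}=\sum_{n\ge0}u_n\frac{x^n}{n!}$, and let $F(x)=\sum_{n\ge 0}u_n x^n$ be the ordinary generating function of $(u_n)$. Then $F(x)$ can be written as a Jacobi continued fraction $F(x)=\mathcal{J}(\alpha_1,\alpha_2,\ldots;\beta_1,\beta_2,\ldots)$, and for such a representation the $\mathbb{T}$ transform $$\mathbb{T}(F)(x)=\cfrac{1}{1-\alpha_1 x-\cfrac{\frac{\beta_1}{1}x^2}{1-(\alpha_2-\alpha_1)x-\cfrac{\frac{\beta_2}{4}x^2}{1-(\alpha_3-\alpha_2)x-\cfrac{\frac{\beta_3}{9}x^2}{1-\cdots}}}}$$ satisfies $g(x)=\operatorname{Rev}\big(\mathbb{T}(F)\big)(x)$, where $\operatorname{Rev}$ denotes the revert transform.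
   Context: For $h(x)\in K[[x]]$ with $h(0)\neq 0$, the revert transform $\operatorname{Rev}(h)(x)$ is $\frac{1}{x}$ times the compositional inverse of the series $x\,h(x)$ (i.e. $\frac1x\,\overline{xh}(x)$ where $\overline{f}(f(x))=x$). For sequences $(\alpha_n)_{n\ge1},(\beta_n)_{n\ge1}$ in $K$, $\mathcal{J}(\alpha_1,\alpha_2,\ldots;\beta_1,\beta_2,\ldots)$ denotes the formal power series given by the Jacobi continued fraction $$\cfrac{1}{1-\alpha_1 x-\cfrac{\beta_1 x^2}{1-\alpha_2 x-\cfrac{\beta_2 x^2}{1-\alpha_3x-\cdots}}}.$$ The $\mathbb{T}$ transform of a series given by such a Jacobi continued fraction is the Jacobi continued fraction with coefficients $\alpha_1,\alpha_2-\alpha_1,\alpha_3-\alpha_2,\ldots$ and $\beta_1/1^2,\beta_2/2^2,\beta_3/3^2,\ldots$, as displayed in the claim. -}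

module Defs where

open import Level using (Level; _⊔_)
open import Algebra.Bundles using (CommutativeRing)
open import Data.Nat as ℕ using (ℕ; zero; suc; NonZero; _!)
open import Data.Nat.Properties using (_!≢0)
open import Relation.Nullary using (¬_)

record Field (c ℓ : Level) : Set (Level.suc (c ⊔ ℓ)) where
  field
    commutativeRing : CommutativeRing c ℓ
  open CommutativeRing commutativeRing public
  field
    0≉1     : ¬ (0# ≈ 1#)
    inv     : (x : Carrier) → ¬ (x ≈ 0#) → Carrier
    inverse : (x : Carrier) (p : ¬ (x ≈ 0#)) → x * inv x p ≈ 1#

module FieldOps {c ℓ : Level} (K : Field c ℓ) where
  open Field K using (Carrier; _≈_; _+_; _-_; _*_; 0#; 1#; inv)

  ofℕ : ℕ → Carrier
  ofℕ zero    = 0#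
  ofℕ (suc n) = 1# + ofℕ n

  CharZero : Set ℓ
  CharZero = (n : ℕ) → .{{_ : NonZero n}} → ¬ (ofℕ n ≈ 0#)

  invℕ : CharZero → (n : ℕ) → .{{_ : NonZero n}} → Carrier
  invℕ ch n = inv (ofℕ n) (ch n)

  sumTo : ℕ → (ℕ → Carrier) → Carrier
  sumTo zero    f = f 0
  sumTo (suc n) f = sumTo n f + f (suc n)

  Series : Set c
  Series = ℕ → Carrier

  infix 4 _≈ₛ_
  _≈ₛ_ : Series → Series → Set ℓ
  f ≈ₛ g = (n : ℕ) → f n ≈ g n

  const : Carrier → Series
  const a zero    = a
  const a (suc n) = 0#

  one : Series
  one = const 1#

  X : Series
  X 1 = 1#
  X _ = 0#

  infixl 6 _⊕_ _⊖_
  infixl 7 _⊛_ _·ₛ_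

  _⊕_ : Series → Series → Series
  (f ⊕ g) n = f n + g n

  _⊖_ : Series → Series → Series
  (f ⊖ g) n = f n - g n

  _·ₛ_ : Carrier → Series → Series
  (a ·ₛ f) n = a * f n

  _⊛_ : Series → Series → Series
  (f ⊛ g) n = sumTo n (λ i → f i * g (n ℕ.∸ i))

  pow : Series → ℕ → Series
  pow f zero    = one
  pow f (suc k) = f ⊛ pow f k

  -- Multiplicative inverse 1/f of a series with constant term 1:
  -- writing f = 1 - u (so u(0) = 0),  1/f = Σ_k u^k, and the coefficient
  -- of x^n only involves k ≤ n.  (Only used for series with f 0 ≈ 1.)
  inv1 : Series → Series
  inv1 f n = sumTo n (λ k → pow (one ⊖ f) k n)

  -- Composition φ(f(x)) for f with f(0) = 0:  [x^n] φ(f) = Σ_{k≤n} φ_k [x^n] f^k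
  _∘ₛ_ : Series → Series → Series
  (φ ∘ₛ f) n = sumTo n (λ k → φ k * pow f k n)

  -- Revert transform.  Rev(h) = (1/x)·\overline{x h}, where \overline{f}
  -- is the compositional inverse: \overline{f}(f(x)) = x.  Hence
  -- "g = Rev(h)" means exactly  (x g)((x h)(x)) = x.

  IsRev : Series → Series → Set ℓ
  IsRev g h = ((X ⊛ g) ∘ₛ (X ⊛ h)) ≈ₛ X

  -- Jacobi continued fractions.  Sequences are indexed from 0, i.e.
  -- α 0 = α₁, α 1 = α₂, ... and likewise for β.
  --
  -- Jd d α β k : the continued fraction starting at level k, truncated
  -- after d levels (the remaining tail replaced by 1).
  Jd : ℕ → (α β : ℕ → Carrier) → ℕ → Series
  Jd zero    α β k = one
  Jd (suc d) α β k =
    inv1 (one ⊖ α k ·ₛ X ⊖ β k ·ₛ (X ⊛ X ⊛ Jd d α β (suc k)))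

  -- The formal power series J(α₁,α₂,…; β₁,β₂,…): its x^n coefficient is
  -- that of any truncation of depth > n/2 (here depth n+1).
  𝒥 : (α β : ℕ → Carrier) → Series
  𝒥 α β n = Jd (suc n) α β 0 n

  Tα : (ℕ → Carrier) → (ℕ → Carrier)
  Tα α zero    = α zero
  Tα α (suc k) = α (suc k) - α k

  Tβ : CharZero → (ℕ → Carrier) → (ℕ → Carrier)
  Tβ ch β k = β k * invℕ ch (suc k ℕ.* suc k)

  𝕋 : CharZero → (α β : ℕ → Carrier) → Series
  𝕋 ch α β = 𝒥 (Tα α) (Tβ ch β)

  gSeries : (a b c' : Carrier) → Series
  gSeries a b c' = (one ⊕ a ·ₛ X) ⊛ inv1 (one ⊕ b ·ₛ X ⊕ c' ·ₛ (X ⊛ X))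

  geSeries : CharZero → (a b c' : Carrier) → Series
  geSeries ch a b c' n = gSeries a b c' n * invℕ ch (n !) {{n !≢0}}

  -- 1/g_e(x) = Σ u_n x^n / n!,  so  u_n = n! · [x^n] (1/g_e)
  uSeq : CharZero → (a b c' : Carrier) → Series
  uSeq ch a b c' n = ofℕ (n !) * inv1 (geSeries ch a b c') n

  FSeries : CharZero → (a b c' : Carrier) → Series
  FSeries = uSeq

module Submission where

-- Put p = b − a, q = b − 2a and r = a² − ab + c, and let κ = x/(1 + bx + cx²), so that
-- g = (1 + ax) κ/x. The coefficient recurrences of g and κ become, for the exponential series,
-- g_e′ = −p g_e − r κ_e and κ_e′ = g_e − a κ_e. Hence U = 1/g_e and f = κ_e U satisfy
-- U′ = (p + r f) U and f′ = 1 + q f + r f², so the derivatives of the series U fᵏ obey the tridiagonal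
-- recurrence (U fᵏ)′ = k U fᵏ⁻¹ + (p + kq) U fᵏ + r(k+1) U fᵏ⁺¹. By the production-matrix form of
-- Flajolet's theorem, F = J(α; β) with α_k = p + kq and β_k = r(k+1)² (indices from 0).
-- The T transform of this fraction has constant coefficients p, q, q, … and r, r, …, so
-- T = 1/(1 − px − rx²H) with H = 1/(1 − qx − rx²H); eliminating H shows that w = xT solves
-- w(1 + aw) = x(1 + bw + cw²), i.e. (x g)(w) = x, which is g = Rev(T).
-- Finally, a J-fraction determines α_k and β_k up to the factor β₀⋯β_{k−1}, and T preserves
-- this ambiguity, so every J-fraction expansion of F has the same T transform.

open import Defs
open import Level using (Level)
open import Algebra.Bundles using (CommutativeRing)
open import Data.Nat as ℕ using (ℕ; zero; suc; _≤_; _<_; z≤n; s≤s; _∸_; _!)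
import Data.Nat.Properties as ℕ
open import Data.Nat.Properties using (_!≢0)
open import Data.Integer as ℤ using (ℤ; +_; -[1+_])
import Data.Integer.Properties as ℤ
import Data.Sign as Sign
open import Data.Maybe using (Maybe; just; nothing)
open import Data.Product using (Σ; _×_; _,_; proj₁; proj₂)
open import Data.Sum using (inj₁; inj₂)
open import Function using (_∘_)
open import Relation.Nullary using (¬_; yes; no)
open import Relation.Binary.PropositionalEquality as ≡ using (_≡_)
import Algebra.Solver.Ring
import Algebra.Solver.Ring.AlmostCommutativeRing as ACR
import Algebra.Properties.Ring
import Algebra.Properties.Semiring.Mult.TCOptimised
import Relation.Binary.Reasoning.Setoid as SetoidReasoning

-- Integer coefficients let the ring solver cancel terms such as x − x.
module IntegerCoefficients {c ℓ : Level} (R : CommutativeRing c ℓ) where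
  open CommutativeRing R
  open Algebra.Properties.Semiring.Mult.TCOptimised semiring using (×-homo-+; ×1-homo-*; 1+×) renaming (_×_ to _×′_)
  open Algebra.Properties.Ring ring using (-‿involutive; -‿distribˡ-*; -‿distribʳ-*; -0#≈0#; -‿+-comm)
  open SetoidReasoning setoid

  ⟦_⟧ : ℤ → Carrier
  ⟦ + n ⟧    = n ×′ 1#
  ⟦ -[1+ n ] ⟧ = - (suc n ×′ 1#)

  ⟦⟧-⊖ : ∀ m n → ⟦ m ℤ.⊖ n ⟧ ≈ m ×′ 1# - n ×′ 1#
  ⟦⟧-⊖ m       zero    = sym (trans (+-congˡ -0#≈0#) (+-identityʳ _))
  ⟦⟧-⊖ zero    (suc n) = sym (+-identityˡ _)
  ⟦⟧-⊖ (suc m) (suc n) = begin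
    ⟦ suc m ℤ.⊖ suc n ⟧                ≡⟨ ≡.cong ⟦_⟧ (ℤ.[1+m]⊖[1+n]≡m⊖n m n) ⟩
    ⟦ m ℤ.⊖ n ⟧                        ≈⟨ ⟦⟧-⊖ m n ⟩
    m ×′ 1# - n ×′ 1#                  ≈⟨ +-congʳ (trans (+-congʳ (-‿inverseʳ 1#)) (+-identityˡ _)) ⟨
    (1# - 1#) + m ×′ 1# - n ×′ 1#      ≈⟨ +-congʳ (trans (+-assoc _ _ _) (trans (+-congˡ (+-comm _ _)) (sym (+-assoc _ _ _)))) ⟩
    (1# + m ×′ 1#) - 1# - n ×′ 1#      ≈⟨ trans (+-assoc _ _ _) (+-congˡ (-‿+-comm 1# (n ×′ 1#))) ⟩
    (1# + m ×′ 1#) - (1# + n ×′ 1#)    ≈⟨ +-cong (1+× m 1#) (-‿cong (1+× n 1#)) ⟨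
    suc m ×′ 1# - suc n ×′ 1#          ∎

  ⟦⟧-+ : ∀ i j → ⟦ i ℤ.+ j ⟧ ≈ ⟦ i ⟧ + ⟦ j ⟧
  ⟦⟧-+ (+ m)    (+ n)    = ×-homo-+ 1# m n
  ⟦⟧-+ (+ m)    -[1+ n ] = ⟦⟧-⊖ m (suc n)
  ⟦⟧-+ -[1+ m ] (+ n)    = trans (⟦⟧-⊖ n (suc m)) (+-comm _ _)
  ⟦⟧-+ -[1+ m ] -[1+ n ] = begin
    ⟦ -[1+ m ] ℤ.+ -[1+ n ] ⟧          ≡⟨ ≡.cong (λ k → - (suc k ×′ 1#)) (ℕ.+-suc m n) ⟨
    - ((suc m ℕ.+ suc n) ×′ 1#)        ≈⟨ -‿cong (×-homo-+ 1# (suc m) (suc n)) ⟩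
    - (suc m ×′ 1# + suc n ×′ 1#)      ≈⟨ -‿+-comm _ _ ⟨
    - (suc m ×′ 1#) + - (suc n ×′ 1#)  ∎

  ⟦⟧-neg : ∀ i → ⟦ ℤ.- i ⟧ ≈ - ⟦ i ⟧
  ⟦⟧-neg -[1+ n ]   = sym (-‿involutive _)
  ⟦⟧-neg (+ zero)   = sym -0#≈0#
  ⟦⟧-neg (+ suc n)  = refl

  ⟦+◃⟧ : ∀ n → ⟦ Sign.+ ℤ.◃ n ⟧ ≈ n ×′ 1#
  ⟦+◃⟧ zero    = refl
  ⟦+◃⟧ (suc n) = refl

  ⟦-◃⟧ : ∀ n → ⟦ Sign.- ℤ.◃ n ⟧ ≈ - (n ×′ 1#)
  ⟦-◃⟧ zero    = sym -0#≈0#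
  ⟦-◃⟧ (suc n) = refl

  ⟦⟧-* : ∀ i j → ⟦ i ℤ.* j ⟧ ≈ ⟦ i ⟧ * ⟦ j ⟧
  ⟦⟧-* (+ m)    (+ n)    = trans (⟦+◃⟧ (m ℕ.* n)) (×1-homo-* m n)
  ⟦⟧-* (+ m)    -[1+ n ] = trans (⟦-◃⟧ (m ℕ.* suc n)) (trans (-‿cong (×1-homo-* m (suc n))) (-‿distribʳ-* _ _))
  ⟦⟧-* -[1+ m ] (+ n)    = trans (⟦-◃⟧ (suc m ℕ.* n)) (trans (-‿cong (×1-homo-* (suc m) n)) (-‿distribˡ-* _ _))
  ⟦⟧-* -[1+ m ] -[1+ n ] = begin
    ⟦ Sign.+ ℤ.◃ (suc m ℕ.* suc n) ⟧   ≈⟨ trans (⟦+◃⟧ (suc m ℕ.* suc n)) (×1-homo-* (suc m) (suc n)) ⟩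
    suc m ×′ 1# * suc n ×′ 1#          ≈⟨ -‿involutive _ ⟨
    - - (suc m ×′ 1# * suc n ×′ 1#)    ≈⟨ -‿cong (-‿distribˡ-* _ _) ⟩
    - (- (suc m ×′ 1#) * suc n ×′ 1#)  ≈⟨ -‿distribʳ-* _ _ ⟩
    - (suc m ×′ 1#) * - (suc n ×′ 1#)  ∎

  private
    homomorphism : ℤ.+-*-rawRing ACR.-Raw-AlmostCommutative⟶ ACR.fromCommutativeRing R
    homomorphism = record
      { ⟦_⟧ = ⟦_⟧ ; +-homo = ⟦⟧-+ ; *-homo = ⟦⟧-* ; -‿homo = ⟦⟧-neg ; 0-homo = refl ; 1-homo = refl }

    ⟦⟧-≟ : ∀ i j → Maybe (⟦ i ⟧ ≈ ⟦ j ⟧)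
    ⟦⟧-≟ i j with i ℤ.≟ j
    ... | yes ≡.refl = just refl
    ... | no _       = nothing

  open Algebra.Solver.Ring ℤ.+-*-rawRing (ACR.fromCommutativeRing R) homomorphism ⟦⟧-≟ public
    using (solve; _:=_; _:+_; _:*_; :-_; _:-_; con)

module FieldArithmetic {c ℓ : Level} (K : Field c ℓ) where
  open Field K
  open FieldOps K
  open IntegerCoefficients commutativeRing using (solve; _:=_; _:*_)
  open SetoidReasoning setoid

  ofℕ-+ : ∀ m n → ofℕ (m ℕ.+ n) ≈ ofℕ m + ofℕ n
  ofℕ-+ zero    n = sym (+-identityˡ _)
  ofℕ-+ (suc m) n = trans (+-congˡ (ofℕ-+ m n)) (sym (+-assoc _ _ _))

  ofℕ-* : ∀ m n → ofℕ (m ℕ.* n) ≈ ofℕ m * ofℕ n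
  ofℕ-* zero    n = sym (zeroˡ _)
  ofℕ-* (suc m) n = trans (ofℕ-+ n (m ℕ.* n)) (trans (+-cong (sym (*-identityˡ _)) (ofℕ-* m n)) (sym (distribʳ _ _ _)))

  inverse-unique : ∀ x y (x≉0 : ¬ (x ≈ 0#)) → x * y ≈ 1# → y ≈ inv x x≉0
  inverse-unique x y x≉0 xy≈1 = begin
    y                   ≈⟨ *-identityʳ y ⟨
    y * 1#              ≈⟨ *-congˡ (inverse x x≉0) ⟨
    y * (x * inv x x≉0) ≈⟨ solve 3 (λ y x i → y :* (x :* i) := (x :* y) :* i) refl y x (inv x x≉0) ⟩
    (x * y) * inv x x≉0 ≈⟨ *-congʳ xy≈1 ⟩
    1# * inv x x≉0      ≈⟨ *-identityˡ _ ⟩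
    inv x x≉0           ∎

module FiniteSums {c ℓ : Level} (K : Field c ℓ) where
  open Field K
  open FieldOps K
  open SetoidReasoning setoid

  sumTo-cong≤ : ∀ n {f g : ℕ → Carrier} → (∀ i → i ≤ n → f i ≈ g i) → sumTo n f ≈ sumTo n g
  sumTo-cong≤ zero    f≈g = f≈g 0 z≤n
  sumTo-cong≤ (suc n) f≈g = +-cong (sumTo-cong≤ n (λ i i≤n → f≈g i (ℕ.m≤n⇒m≤1+n i≤n))) (f≈g (suc n) ℕ.≤-refl)

  sumTo-cong : ∀ n {f g : ℕ → Carrier} → (∀ i → f i ≈ g i) → sumTo n f ≈ sumTo n g
  sumTo-cong n f≈g = sumTo-cong≤ n (λ i _ → f≈g i)

  sumTo-zero : ∀ n {f : ℕ → Carrier} → (∀ i → i ≤ n → f i ≈ 0#) → sumTo n f ≈ 0#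
  sumTo-zero zero    f≈0 = f≈0 0 z≤n
  sumTo-zero (suc n) f≈0 =
    trans (+-cong (sumTo-zero n (λ i i≤n → f≈0 i (ℕ.m≤n⇒m≤1+n i≤n))) (f≈0 (suc n) ℕ.≤-refl)) (+-identityˡ 0#)

  sumTo-distrib-+ : ∀ n (f g : ℕ → Carrier) → sumTo n (λ i → f i + g i) ≈ sumTo n f + sumTo n g
  sumTo-distrib-+ zero    f g = refl
  sumTo-distrib-+ (suc n) f g = begin
    sumTo n (λ i → f i + g i) + (f (suc n) + g (suc n))  ≈⟨ +-congʳ (sumTo-distrib-+ n f g) ⟩
    (sumTo n f + sumTo n g) + (f (suc n) + g (suc n))    ≈⟨ +-assoc _ _ _ ⟩
    sumTo n f + (sumTo n g + (f (suc n) + g (suc n)))    ≈⟨ +-congˡ (+-assoc _ _ _) ⟨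
    sumTo n f + ((sumTo n g + f (suc n)) + g (suc n))    ≈⟨ +-congˡ (+-congʳ (+-comm _ _)) ⟩
    sumTo n f + ((f (suc n) + sumTo n g) + g (suc n))    ≈⟨ +-congˡ (+-assoc _ _ _) ⟩
    sumTo n f + (f (suc n) + (sumTo n g + g (suc n)))    ≈⟨ +-assoc _ _ _ ⟨
    sumTo (suc n) f + sumTo (suc n) g                    ∎

  sumTo-distribˡ : ∀ n a (f : ℕ → Carrier) → a * sumTo n f ≈ sumTo n (λ i → a * f i)
  sumTo-distribˡ zero    a f = refl
  sumTo-distribˡ (suc n) a f = trans (distribˡ _ _ _) (+-congʳ (sumTo-distribˡ n a f))

  sumTo-distribʳ : ∀ n a (f : ℕ → Carrier) → sumTo n f * a ≈ sumTo n (λ i → f i * a)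
  sumTo-distribʳ n a f = trans (*-comm _ _) (trans (sumTo-distribˡ n a f) (sumTo-cong n (λ i → *-comm _ _)))

  sumTo-suc : ∀ n (f : ℕ → Carrier) → sumTo (suc n) f ≈ f 0 + sumTo n (f ∘ suc)
  sumTo-suc zero    f = refl
  sumTo-suc (suc n) f = trans (+-congʳ (sumTo-suc n f)) (+-assoc _ _ _)

  sumTo-head : ∀ n {f : ℕ → Carrier} → (∀ i → f (suc i) ≈ 0#) → sumTo n f ≈ f 0
  sumTo-head zero    f≈0 = refl
  sumTo-head (suc n) f≈0 = trans (sumTo-suc n _) (trans (+-congˡ (sumTo-zero n (λ i _ → f≈0 i))) (+-identityʳ _))

  sumTo-reverse : ∀ n (f : ℕ → Carrier) → sumTo n f ≈ sumTo n (λ i → f (n ∸ i))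
  sumTo-reverse zero    f = refl
  sumTo-reverse (suc n) f = begin
    sumTo n f + f (suc n)                      ≈⟨ +-comm _ _ ⟩
    f (suc n) + sumTo n f                      ≈⟨ +-congˡ (sumTo-reverse n f) ⟩
    f (suc n) + sumTo n (λ i → f (n ∸ i))      ≈⟨ sumTo-suc n (λ i → f (suc n ∸ i)) ⟨
    sumTo (suc n) (λ i → f (suc n ∸ i))        ∎

  sumTo-extend : ∀ m n (f : ℕ → Carrier) → m ≤ n → (∀ j → m < j → j ≤ n → f j ≈ 0#) → sumTo n f ≈ sumTo m f
  sumTo-extend m zero    f z≤n _   = refl
  sumTo-extend m (suc n) f m≤1+n f≈0 with ℕ.m≤n⇒m<n∨m≡n m≤1+n
  ... | inj₁ m<1+n = trans (+-cong (sumTo-extend m n f (ℕ.≤-pred m<1+n) (λ j m<j j≤n → f≈0 j m<j (ℕ.m≤n⇒m≤1+n j≤n)))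
                                             (f≈0 (suc n) m<1+n ℕ.≤-refl)) (+-identityʳ _)
  ... | inj₂ ≡.refl = refl

  sumTriangle : ℕ → (ℕ → ℕ → Carrier) → Carrier
  sumTriangle n h = sumTo n (λ i → sumTo (n ∸ i) (h i))

  sumAntidiagonal : ℕ → (ℕ → ℕ → Carrier) → Carrier
  sumAntidiagonal n h = sumTo n (λ i → h i (n ∸ i))

  sumTriangle-suc : ∀ n h → sumTriangle (suc n) h ≈ sumTriangle n h + sumAntidiagonal (suc n) h
  sumTriangle-suc n h = begin
    sumTo n (λ i → sumTo (suc n ∸ i) (h i)) + sumTo (n ∸ n) (h (suc n))
      ≈⟨ +-cong (sumTo-cong≤ n lastColumn) (singleton (ℕ.n∸n≡0 n)) ⟩
    sumTo n (λ i → sumTo (n ∸ i) (h i) + h i (suc n ∸ i)) + h (suc n) (n ∸ n)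
      ≈⟨ +-congʳ (sumTo-distrib-+ n _ _) ⟩
    (sumTriangle n h + sumTo n (λ i → h i (suc n ∸ i))) + h (suc n) (n ∸ n)
      ≈⟨ +-assoc _ _ _ ⟩
    sumTriangle n h + sumAntidiagonal (suc n) h  ∎
    where
    lastColumn : ∀ i → i ≤ n → sumTo (suc n ∸ i) (h i) ≈ sumTo (n ∸ i) (h i) + h i (suc n ∸ i)
    lastColumn i i≤n rewrite ℕ.+-∸-assoc 1 i≤n = refl
    singleton : ∀ {t} → t ≡ 0 → sumTo t (h (suc n)) ≈ h (suc n) t
    singleton ≡.refl = refl

  sumAntidiagonal-transpose : ∀ n h → sumAntidiagonal n h ≈ sumAntidiagonal n (λ i j → h j i)
  sumAntidiagonal-transpose n h = trans
    (sumTo-cong≤ n (λ i i≤n → reflexive (≡.cong (λ t → h t (n ∸ i)) (≡.sym (ℕ.m∸[m∸n]≡n i≤n)))))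
    (sym (sumTo-reverse n (λ i → h (n ∸ i) i)))

  sumTriangle-transpose : ∀ n h → sumTriangle n h ≈ sumTriangle n (λ i j → h j i)
  sumTriangle-transpose zero    h = refl
  sumTriangle-transpose (suc n) h = begin
    sumTriangle (suc n) h                                           ≈⟨ sumTriangle-suc n h ⟩
    sumTriangle n h + sumAntidiagonal (suc n) h                     ≈⟨ +-cong (sumTriangle-transpose n h) (sumAntidiagonal-transpose (suc n) h) ⟩
    sumTriangle n (λ i j → h j i) + sumAntidiagonal (suc n) (λ i j → h j i)  ≈⟨ sumTriangle-suc n (λ i j → h j i) ⟨
    sumTriangle (suc n) (λ i j → h j i)                             ∎

  sumTo-comm : ∀ m n (h : ℕ → ℕ → Carrier) → sumTo m (λ i → sumTo n (h i)) ≈ sumTo n (λ j → sumTo m (λ i → h i j))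
  sumTo-comm zero    n h = refl
  sumTo-comm (suc m) n h = trans (+-congʳ (sumTo-comm m n h)) (sym (sumTo-distrib-+ n _ _))

module SeriesRing {c ℓ : Level} (K : Field c ℓ) where
  open Field K
  open FieldOps K
  open FiniteSums K
  module ≈-Reasoning = SetoidReasoning setoid

  infix 4 _≋_ _≈[_]_

  -- A record rather than _≈ₛ_ itself, so that both sides can be inferred and are not unfolded.
  record _≋_ (f g : Series) : Set ℓ where
    constructor mk≋
    field coeff : f ≈ₛ g
  open _≋_ public

  _≈[_]_ : Series → ℕ → Series → Set ℓ
  f ≈[ N ] g = ∀ i → i ≤ N → f i ≈ g i

  0ₛ : Series
  0ₛ _ = 0#

  negₛ : Series → Series
  negₛ f n = - f n

  ⊛-cong≤ : ∀ N {f f′ g g′} → f ≈[ N ] f′ → g ≈[ N ] g′ → f ⊛ g ≈[ N ] f′ ⊛ g′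
  ⊛-cong≤ N f≈f′ g≈g′ n n≤N = sumTo-cong≤ n (λ i i≤n →
    *-cong (f≈f′ i (ℕ.≤-trans i≤n n≤N)) (g≈g′ (n ∸ i) (ℕ.≤-trans (ℕ.m∸n≤m n i) n≤N)))

  ⊛-cong : ∀ {f f′ g g′} → f ≈ₛ f′ → g ≈ₛ g′ → f ⊛ g ≈ₛ f′ ⊛ g′
  ⊛-cong f≈f′ g≈g′ n = sumTo-cong n (λ i → *-cong (f≈f′ i) (g≈g′ (n ∸ i)))

  ⊛-comm : ∀ f g → f ⊛ g ≈ₛ g ⊛ f
  ⊛-comm f g n = trans (sumTo-reverse n _) (sumTo-cong≤ n (λ i i≤n →
    trans (*-comm _ _) (*-congʳ (reflexive (≡.cong g (ℕ.m∸[m∸n]≡n i≤n))))))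

  ⊛-identityˡ : ∀ f → one ⊛ f ≈ₛ f
  ⊛-identityˡ f n = trans (sumTo-head n (λ i → zeroˡ _)) (*-identityˡ _)

  ⊛-distribʳ : ∀ f g h → (g ⊕ h) ⊛ f ≈ₛ (g ⊛ f) ⊕ (h ⊛ f)
  ⊛-distribʳ f g h n = trans (sumTo-cong n (λ i → distribʳ _ _ _)) (sumTo-distrib-+ n _ _)

  ⊛-assoc : ∀ f g h → (f ⊛ g) ⊛ h ≈ₛ f ⊛ (g ⊛ h)
  ⊛-assoc f g h n = begin
    sumTo n (λ i → sumTo i (λ j → f j * g (i ∸ j)) * h (n ∸ i))
      ≈⟨ sumTo-cong n (λ i → sumTo-distribʳ i _ _) ⟩
    sumTo n (λ i → sumTo i (λ j → f j * g (i ∸ j) * h (n ∸ i)))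
      ≈⟨ sumTo-reverse n _ ⟩
    sumTo n (λ t → sumTo (n ∸ t) (λ j → f j * g (n ∸ t ∸ j) * h (n ∸ (n ∸ t))))
      ≈⟨ sumTo-cong≤ n (λ t t≤n → sumTo-cong (n ∸ t) (λ j → *-congˡ (reflexive (≡.cong h (ℕ.m∸[m∸n]≡n t≤n))))) ⟩
    sumTriangle n (λ t j → f j * g (n ∸ t ∸ j) * h t)
      ≈⟨ sumTriangle-transpose n _ ⟩
    sumTo n (λ j → sumTo (n ∸ j) (λ t → f j * g (n ∸ t ∸ j) * h t))
      ≈⟨ sumTo-cong n inner ⟩
    sumTo n (λ j → f j * sumTo (n ∸ j) (λ k → g k * h (n ∸ j ∸ k)))  ∎
    where
    open ≈-Reasoning
    ∸-swap : ∀ j t → n ∸ t ∸ j ≡ n ∸ j ∸ t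
    ∸-swap j t = ≡.trans (ℕ.∸-+-assoc n t j) (≡.trans (≡.cong (n ∸_) (ℕ.+-comm t j)) (≡.sym (ℕ.∸-+-assoc n j t)))
    inner : ∀ j → sumTo (n ∸ j) (λ t → f j * g (n ∸ t ∸ j) * h t) ≈ f j * sumTo (n ∸ j) (λ k → g k * h (n ∸ j ∸ k))
    inner j = begin
      sumTo (n ∸ j) (λ t → f j * g (n ∸ t ∸ j) * h t)
        ≈⟨ sumTo-reverse (n ∸ j) _ ⟩
      sumTo (n ∸ j) (λ k → f j * g (n ∸ (n ∸ j ∸ k) ∸ j) * h (n ∸ j ∸ k))
        ≈⟨ sumTo-cong≤ (n ∸ j) (λ k k≤ → trans (*-assoc _ _ _) (*-congˡ (*-congʳ (reflexive (≡.cong g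
             (≡.trans (∸-swap j (n ∸ j ∸ k)) (ℕ.m∸[m∸n]≡n k≤))))))) ⟩
      sumTo (n ∸ j) (λ k → f j * (g k * h (n ∸ j ∸ k)))
        ≈⟨ sumTo-distribˡ (n ∸ j) _ _ ⟨
      f j * sumTo (n ∸ j) (λ k → g k * h (n ∸ j ∸ k))  ∎

  seriesRing : CommutativeRing c ℓ
  seriesRing = record
    { Carrier = Series ; _≈_ = _≋_ ; _+_ = _⊕_ ; _*_ = _⊛_ ; -_ = negₛ ; 0# = 0ₛ ; 1# = one
    ; isCommutativeRing = record
      { isRing = record
        { +-isAbelianGroup = record
          { isGroup = record
            { isMonoid = record
              { isSemigroup = record
                { isMagma = record
                  { isEquivalence = record
                    { refl  = mk≋ (λ _ → refl)
                    ; sym   = λ (mk≋ p) → mk≋ (λ n → sym (p n))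
                    ; trans = λ (mk≋ p) (mk≋ q) → mk≋ (λ n → trans (p n) (q n)) }
                  ; ∙-cong = λ (mk≋ p) (mk≋ q) → mk≋ (λ n → +-cong (p n) (q n)) }
                ; assoc = λ _ _ _ → mk≋ (λ _ → +-assoc _ _ _) }
              ; identity = (λ _ → mk≋ (λ _ → +-identityˡ _)) , (λ _ → mk≋ (λ _ → +-identityʳ _)) }
            ; inverse = (λ _ → mk≋ (λ _ → -‿inverseˡ _)) , (λ _ → mk≋ (λ _ → -‿inverseʳ _))
            ; ⁻¹-cong = λ (mk≋ p) → mk≋ (λ n → -‿cong (p n)) }
          ; comm = λ _ _ → mk≋ (λ _ → +-comm _ _) }
        ; *-cong   = λ (mk≋ p) (mk≋ q) → mk≋ (⊛-cong p q)
        ; *-assoc  = λ f g h → mk≋ (⊛-assoc f g h)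
        ; *-identity = (λ f → mk≋ (⊛-identityˡ f)) , (λ f → mk≋ (λ n → trans (⊛-comm f one n) (⊛-identityˡ f n)))
        ; distrib  = (λ f g h → mk≋ (λ n → trans (⊛-comm f (g ⊕ h) n) (trans (⊛-distribʳ f g h n)
                                    (+-cong (⊛-comm g f n) (⊛-comm h f n)))))
                   , (λ f g h → mk≋ (⊛-distribʳ f g h)) }
      ; *-comm = λ f g → mk≋ (⊛-comm f g) } }

  module S = CommutativeRing seriesRing
  module ≋-Reasoning = SetoidReasoning S.setoid
  open IntegerCoefficients seriesRing public using ()
    renaming (solve to solveₛ; _:=_ to _:=ₛ_; _:+_ to _⊞_; _:*_ to _⊠_; _:-_ to _⊟_; :-_ to ⊟_; con to conₛ)

  X⊛-zero : ∀ f → (X ⊛ f) 0 ≈ 0#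
  X⊛-zero f = zeroˡ _

  X⊛-suc : ∀ f n → (X ⊛ f) (suc n) ≈ f n
  X⊛-suc f n = begin
    (X ⊛ f) (suc n)                                    ≈⟨ sumTo-suc n _ ⟩
    0# * f (suc n) + sumTo n (λ i → X (suc i) * f (n ∸ i))  ≈⟨ +-cong (zeroˡ _) (sumTo-head n (λ i → zeroˡ _)) ⟩
    0# + 1# * f n                                      ≈⟨ trans (+-identityˡ _) (*-identityˡ _) ⟩
    f n                                                ∎
    where open ≈-Reasoning

  const⊛ : ∀ a f n → (const a ⊛ f) n ≈ a * f n
  const⊛ a f n = sumTo-head n (λ i → zeroˡ _)

  const⊛X⊛-suc : ∀ a f n → (const a ⊛ (X ⊛ f)) (suc n) ≈ a * f n
  const⊛X⊛-suc a f n = trans (const⊛ a (X ⊛ f) (suc n)) (*-congˡ (X⊛-suc f n))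

  ·ₛ≋const⊛ : ∀ a f → a ·ₛ f ≋ const a ⊛ f
  ·ₛ≋const⊛ a f = mk≋ (λ n → sym (const⊛ a f n))

  const-cong : ∀ {x y} → x ≈ y → const x ≋ const y
  const-cong x≈y = mk≋ λ { zero → x≈y ; (suc n) → refl }

  const-0≋0ₛ : const 0# ≋ 0ₛ
  const-0≋0ₛ = mk≋ λ { zero → refl ; (suc n) → refl }

  const-+ : ∀ x y → const (x + y) ≋ const x ⊕ const y
  const-+ x y = mk≋ λ { zero → refl ; (suc n) → sym (+-identityʳ 0#) }

  const-neg : ∀ x → const (- x) ≋ negₛ (const x)
  const-neg x = mk≋ λ { zero → refl ; (suc n) → sym (Algebra.Properties.Ring.-0#≈0# ring) }

  const-* : ∀ x y → const (x * y) ≋ const x ⊛ const y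
  const-* x y = mk≋ λ { zero → refl ; (suc n) → sym (trans (const⊛ x (const y) (suc n)) (zeroʳ x)) }

  pow-vanishes : ∀ u → u 0 ≈ 0# → ∀ k n → n < k → pow u k n ≈ 0#
  pow-vanishes u u₀≈0 (suc k) zero    _           = trans (*-congʳ u₀≈0) (zeroˡ _)
  pow-vanishes u u₀≈0 (suc k) (suc n) (s≤s n<k) = begin
    (u ⊛ pow u k) (suc n)                                                ≈⟨ sumTo-suc n _ ⟩
    u 0 * pow u k (suc n) + sumTo n (λ i → u (suc i) * pow u k (n ∸ i))  ≈⟨ +-cong (trans (*-congʳ u₀≈0) (zeroˡ _)) (sumTo-zero n tail≈0) ⟩
    0# + 0#                                                              ≈⟨ +-identityʳ 0# ⟩
    0#                                                                   ∎
    where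
    open ≈-Reasoning
    tail≈0 : ∀ i → i ≤ n → u (suc i) * pow u k (n ∸ i) ≈ 0#
    tail≈0 i _ = trans (*-congˡ (pow-vanishes u u₀≈0 k (n ∸ i) (ℕ.≤-<-trans (ℕ.m∸n≤m n i) n<k))) (zeroʳ _)

  pow-cong≤ : ∀ N {f f′} → f ≈[ N ] f′ → ∀ k → pow f k ≈[ N ] pow f′ k
  pow-cong≤ N f≈f′ zero    i _ = refl
  pow-cong≤ N f≈f′ (suc k)     = ⊛-cong≤ N f≈f′ (pow-cong≤ N f≈f′ k)

  inv1-cong≤ : ∀ N {f f′} → f ≈[ N ] f′ → inv1 f ≈[ N ] inv1 f′
  inv1-cong≤ N f≈f′ n n≤N = sumTo-cong n (λ k → pow-cong≤ N (λ i i≤N → +-congˡ (-‿cong (f≈f′ i i≤N))) k n n≤N)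

  inv1-cong : ∀ {f f′} → f ≋ f′ → inv1 f ≋ inv1 f′
  inv1-cong (mk≋ f≈f′) = mk≋ (λ n → inv1-cong≤ n (λ i _ → f≈f′ i) n ℕ.≤-refl)

  geometricSum : Series → ℕ → Series
  geometricSum u zero    = one
  geometricSum u (suc N) = geometricSum u N ⊕ pow u (suc N)

  geometricSum-telescopes : ∀ u N → (one ⊖ u) ⊛ geometricSum u N ≋ one ⊖ pow u (suc N)
  geometricSum-telescopes u zero = solveₛ 1 (λ U → (conₛ (+ 1) ⊟ U) ⊠ conₛ (+ 1) :=ₛ conₛ (+ 1) ⊟ U ⊠ conₛ (+ 1)) S.refl u
  geometricSum-telescopes u (suc N) = begin
    (one ⊖ u) ⊛ (geometricSum u N ⊕ pow u (suc N))
      ≈⟨ S.distribˡ (one ⊖ u) (geometricSum u N) (pow u (suc N)) ⟩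
    (one ⊖ u) ⊛ geometricSum u N ⊕ (one ⊖ u) ⊛ pow u (suc N)
      ≈⟨ S.+-congʳ (geometricSum-telescopes u N) ⟩
    (one ⊖ pow u (suc N)) ⊕ (one ⊖ u) ⊛ pow u (suc N)
      ≈⟨ solveₛ 2 (λ U P → (conₛ (+ 1) ⊟ U ⊠ P) ⊞ (conₛ (+ 1) ⊟ U) ⊠ (U ⊠ P) :=ₛ conₛ (+ 1) ⊟ U ⊠ (U ⊠ P)) S.refl u (pow u N) ⟩
    one ⊖ pow u (suc (suc N))  ∎
    where open ≋-Reasoning

  inv1-inverse : ∀ f → f 0 ≈ 1# → f ⊛ inv1 f ≋ one
  inv1-inverse f f₀≈1 = mk≋ coefficientwise
    where
    open ≈-Reasoning
    open Algebra.Properties.Ring ring using (-0#≈0#)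
    open IntegerCoefficients commutativeRing using (solve; _:=_; _:-_)
    u = one ⊖ f
    u₀≈0 : u 0 ≈ 0#
    u₀≈0 = trans (+-congˡ (-‿cong f₀≈1)) (-‿inverseʳ _)
    f≈1-u : ∀ i → f i ≈ (one ⊖ u) i
    f≈1-u i = solve 2 (λ a b → b := a :- (a :- b)) refl (one i) (f i)
    geometricSum-coeff : ∀ N m → geometricSum u N m ≈ sumTo N (λ k → pow u k m)
    geometricSum-coeff zero    m = refl
    geometricSum-coeff (suc N) m = +-congʳ (geometricSum-coeff N m)
    inv1≈geometric : ∀ n → inv1 f ≈[ n ] geometricSum u n
    inv1≈geometric n m m≤n = sym (trans (geometricSum-coeff n m)
      (sumTo-extend m n _ m≤n (λ j m<j _ → pow-vanishes u u₀≈0 j m m<j)))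
    coefficientwise : ∀ n → (f ⊛ inv1 f) n ≈ one n
    coefficientwise n = begin
      (f ⊛ inv1 f) n                   ≈⟨ ⊛-cong≤ n (λ i _ → f≈1-u i) (inv1≈geometric n) n ℕ.≤-refl ⟩
      ((one ⊖ u) ⊛ geometricSum u n) n  ≈⟨ coeff (geometricSum-telescopes u n) n ⟩
      one n - pow u (suc n) n          ≈⟨ +-congˡ (trans (-‿cong (pow-vanishes u u₀≈0 (suc n) n ℕ.≤-refl)) -0#≈0#) ⟩
      one n + 0#                       ≈⟨ +-identityʳ _ ⟩
      one n                            ∎

  X²⊛-zero : ∀ f → (X ⊛ X ⊛ f) 0 ≈ 0#
  X²⊛-zero f = trans (⊛-assoc X X f 0) (X⊛-zero (X ⊛ f))

  X²⊛-one : ∀ f → (X ⊛ X ⊛ f) 1 ≈ 0#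
  X²⊛-one f = trans (⊛-assoc X X f 1) (trans (X⊛-suc (X ⊛ f) 0) (X⊛-zero f))

  X²⊛-suc-suc : ∀ f n → (X ⊛ X ⊛ f) (suc (suc n)) ≈ f n
  X²⊛-suc-suc f n = trans (⊛-assoc X X f (suc (suc n))) (trans (X⊛-suc (X ⊛ f) (suc n)) (X⊛-suc f n))

  ⊛-cancelˡ-unit : ∀ d {f g} → d 0 ≈ 1# → d ⊛ f ≋ d ⊛ g → f ≋ g
  ⊛-cancelˡ-unit d {f} {g} d₀≈1 df≈dg = begin
    f                      ≈⟨ S.*-identityˡ f ⟨
    one ⊛ f                ≈⟨ S.*-congʳ {f} d⁻¹d ⟨
    (inv1 d ⊛ d) ⊛ f       ≈⟨ S.*-assoc (inv1 d) d f ⟩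
    inv1 d ⊛ (d ⊛ f)       ≈⟨ S.*-congˡ df≈dg ⟩
    inv1 d ⊛ (d ⊛ g)       ≈⟨ S.*-assoc (inv1 d) d g ⟨
    (inv1 d ⊛ d) ⊛ g       ≈⟨ S.*-congʳ {g} d⁻¹d ⟩
    one ⊛ g                ≈⟨ S.*-identityˡ g ⟩
    g                      ∎
    where
    open ≋-Reasoning
    d⁻¹d : inv1 d ⊛ d ≋ one
    d⁻¹d = S.trans (S.*-comm (inv1 d) d) (inv1-inverse d d₀≈1)

  scaled-inverses-agree : ∀ {s t s′ t′} e → s ⊛ t ≋ one → s′ ⊛ t′ ≋ one → e ⊛ s ≋ e ⊛ s′ → e ⊛ t ≋ e ⊛ t′
  scaled-inverses-agree {s} {t} {s′} {t′} e st≈1 s′t′≈1 es≈es′ = begin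
    e ⊛ t                    ≈⟨ S.*-identityʳ (e ⊛ t) ⟨
    (e ⊛ t) ⊛ one            ≈⟨ S.*-congˡ s′t′≈1 ⟨
    (e ⊛ t) ⊛ (s′ ⊛ t′)      ≈⟨ solveₛ 5 (λ E T S′ T′ S → (E ⊠ T) ⊠ (S′ ⊠ T′) :=ₛ (T ⊠ T′) ⊠ (E ⊠ S′)) S.refl e t s′ t′ s ⟩
    (t ⊛ t′) ⊛ (e ⊛ s′)      ≈⟨ S.*-congˡ es≈es′ ⟨
    (t ⊛ t′) ⊛ (e ⊛ s)       ≈⟨ solveₛ 5 (λ E T S′ T′ S → (T ⊠ T′) ⊠ (E ⊠ S) :=ₛ (E ⊠ T′) ⊠ (S ⊠ T)) S.refl e t s′ t′ s ⟩
    (e ⊛ t′) ⊛ (s ⊛ t)       ≈⟨ S.*-congˡ st≈1 ⟩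
    (e ⊛ t′) ⊛ one           ≈⟨ S.*-identityʳ (e ⊛ t′) ⟩
    e ⊛ t′                   ∎
    where open ≋-Reasoning

module Composition {c ℓ : Level} (K : Field c ℓ) where
  open Field K
  open FieldOps K
  open FiniteSums K
  open SeriesRing K
  open IntegerCoefficients commutativeRing using (solve; _:=_; _:*_)

  ∘ₛ-congˡ : ∀ {φ φ′} w → φ ≋ φ′ → φ ∘ₛ w ≋ φ′ ∘ₛ w
  ∘ₛ-congˡ w (mk≋ φ≈φ′) = mk≋ (λ n → sumTo-cong n (λ k → *-congʳ (φ≈φ′ k)))

  ∘ₛ-congʳ : ∀ φ {w w′} → w ≋ w′ → φ ∘ₛ w ≋ φ ∘ₛ w′
  ∘ₛ-congʳ φ (mk≋ w≈w′) = mk≋ (λ n → sumTo-cong n (λ k → *-congˡ (pow-cong≤ n (λ i _ → w≈w′ i) k n ℕ.≤-refl)))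

  ∘ₛ-distrib-⊕ : ∀ φ ψ w → (φ ⊕ ψ) ∘ₛ w ≋ (φ ∘ₛ w) ⊕ (ψ ∘ₛ w)
  ∘ₛ-distrib-⊕ φ ψ w = mk≋ (λ n → trans (sumTo-cong n (λ k → distribʳ _ _ _)) (sumTo-distrib-+ n _ _))

  ∘ₛ-const⊛ : ∀ a φ w → (const a ⊛ φ) ∘ₛ w ≋ const a ⊛ (φ ∘ₛ w)
  ∘ₛ-const⊛ a φ w = mk≋ λ n → trans (sumTo-cong n (λ k → trans (*-congʳ (const⊛ a φ k)) (*-assoc _ _ _)))
                                     (trans (sym (sumTo-distribˡ n a _)) (sym (const⊛ a (φ ∘ₛ w) n)))

  ∘ₛ-one : ∀ w → one ∘ₛ w ≋ one
  ∘ₛ-one w = mk≋ λ n → trans (sumTo-head n (λ _ → zeroˡ _)) (*-identityˡ _)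

  ∘ₛ-X⊛ : ∀ φ w → w 0 ≈ 0# → (X ⊛ φ) ∘ₛ w ≋ w ⊛ (φ ∘ₛ w)
  ∘ₛ-X⊛ φ w w₀≈0 = mk≋ coefficientwise
    where
    open ≈-Reasoning
    coefficientwise : ∀ n → ((X ⊛ φ) ∘ₛ w) n ≈ (w ⊛ (φ ∘ₛ w)) n
    coefficientwise zero = trans (*-congʳ (X⊛-zero φ)) (trans (zeroˡ _) (sym (trans (*-congʳ w₀≈0) (zeroˡ _))))
    coefficientwise (suc m) = begin
      sumTo (suc m) (λ k → (X ⊛ φ) k * pow w k (suc m))
        ≈⟨ sumTo-suc m _ ⟩
      (X ⊛ φ) 0 * pow w 0 (suc m) + sumTo m (λ j → (X ⊛ φ) (suc j) * pow w (suc j) (suc m))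
        ≈⟨ +-cong (trans (*-congʳ (X⊛-zero φ)) (zeroˡ _)) (sumTo-cong m (λ j → *-congʳ (X⊛-suc φ j))) ⟩
      0# + sumTo m (λ j → φ j * pow w (suc j) (suc m))
        ≈⟨ +-identityˡ _ ⟩
      sumTo m (λ j → φ j * pow w (suc j) (suc m))
        ≈⟨ sumTo-extend m (suc m) _ (ℕ.n≤1+n m) (λ { j m<j j≤m+1 →
             trans (*-congˡ (pow-vanishes w w₀≈0 (suc j) (suc m) (s≤s (ℕ.≤-reflexive (ℕ.≤-antisym m<j j≤m+1))))) (zeroʳ _) }) ⟨
      sumTo (suc m) (λ j → φ j * pow w (suc j) (suc m))
        ≈⟨ sumTo-cong (suc m) (λ j → sumTo-distribˡ (suc m) (φ j) _) ⟩
      sumTo (suc m) (λ j → sumTo (suc m) (λ i → φ j * (w i * pow w j (suc m ∸ i))))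
        ≈⟨ sumTo-comm (suc m) (suc m) _ ⟩
      sumTo (suc m) (λ i → sumTo (suc m) (λ j → φ j * (w i * pow w j (suc m ∸ i))))
        ≈⟨ sumTo-cong≤ (suc m) inner ⟩
      (w ⊛ (φ ∘ₛ w)) (suc m) ∎
      where
      inner : ∀ i → i ≤ suc m → sumTo (suc m) (λ j → φ j * (w i * pow w j (suc m ∸ i))) ≈ w i * (φ ∘ₛ w) (suc m ∸ i)
      inner i _ = begin
        sumTo (suc m) (λ j → φ j * (w i * pow w j (suc m ∸ i)))
          ≈⟨ sumTo-extend (suc m ∸ i) (suc m) _ (ℕ.m∸n≤m _ i)
               (λ j lt _ → trans (*-congˡ (trans (*-congˡ (pow-vanishes w w₀≈0 j (suc m ∸ i) lt)) (zeroʳ _))) (zeroʳ _)) ⟩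
        sumTo (suc m ∸ i) (λ j → φ j * (w i * pow w j (suc m ∸ i)))
          ≈⟨ sumTo-cong (suc m ∸ i) (λ j → solve 3 (λ x y z → x :* (y :* z) := y :* (x :* z)) refl (φ j) (w i) _) ⟩
        sumTo (suc m ∸ i) (λ j → w i * (φ j * pow w j (suc m ∸ i)))
          ≈⟨ sumTo-distribˡ (suc m ∸ i) (w i) _ ⟨
        w i * (φ ∘ₛ w) (suc m ∸ i)  ∎

  IsRev-cong : ∀ g {h h′} → h ≈ₛ h′ → IsRev g h → IsRev g h′
  IsRev-cong g {h} {h′} h≈h′ g-reverts-h =
    coeff (S.trans (S.sym (∘ₛ-congʳ (X ⊛ g) (S.*-congˡ {X} (mk≋ h≈h′)))) (mk≋ g-reverts-h))

  quadratic : Carrier → Carrier → Carrier → Series → Series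
  quadratic s t u w = const s ⊕ const t ⊛ w ⊕ const u ⊛ (w ⊛ w)

  ∘ₛ-quadratic⊛ : ∀ s t u φ w → w 0 ≈ 0# → (quadratic s t u X ⊛ φ) ∘ₛ w ≋ quadratic s t u w ⊛ (φ ∘ₛ w)
  ∘ₛ-quadratic⊛ s t u φ w w₀≈0 = begin
    (quadratic s t u X ⊛ φ) ∘ₛ w
      ≈⟨ ∘ₛ-congˡ w (solveₛ 5 (λ S T U Y F → (S ⊞ T ⊠ Y ⊞ U ⊠ (Y ⊠ Y)) ⊠ F :=ₛ S ⊠ F ⊞ T ⊠ (Y ⊠ F) ⊞ U ⊠ (Y ⊠ (Y ⊠ F)))
                         S.refl (const s) (const t) (const u) X φ) ⟩
    (const s ⊛ φ ⊕ const t ⊛ (X ⊛ φ) ⊕ const u ⊛ (X ⊛ (X ⊛ φ))) ∘ₛ w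
      ≈⟨ S.trans (∘ₛ-distrib-⊕ _ _ w) (S.+-cong (∘ₛ-distrib-⊕ _ _ w) (∘ₛ-const⊛ u _ w)) ⟩
    ((const s ⊛ φ) ∘ₛ w ⊕ (const t ⊛ (X ⊛ φ)) ∘ₛ w) ⊕ const u ⊛ ((X ⊛ (X ⊛ φ)) ∘ₛ w)
      ≈⟨ S.+-cong (S.+-cong (∘ₛ-const⊛ s φ w) (∘ₛ-const⊛ t _ w)) (S.*-congˡ (S.trans (∘ₛ-X⊛ (X ⊛ φ) w w₀≈0) (S.*-congˡ (∘ₛ-X⊛ φ w w₀≈0)))) ⟩
    const s ⊛ (φ ∘ₛ w) ⊕ const t ⊛ ((X ⊛ φ) ∘ₛ w) ⊕ const u ⊛ (w ⊛ (w ⊛ (φ ∘ₛ w)))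
      ≈⟨ S.+-congʳ (S.+-congˡ (S.*-congˡ (∘ₛ-X⊛ φ w w₀≈0))) ⟩
    const s ⊛ (φ ∘ₛ w) ⊕ const t ⊛ (w ⊛ (φ ∘ₛ w)) ⊕ const u ⊛ (w ⊛ (w ⊛ (φ ∘ₛ w)))
      ≈⟨ solveₛ 5 (λ S T U W F → S ⊠ F ⊞ T ⊠ (W ⊠ F) ⊞ U ⊠ (W ⊠ (W ⊠ F)) :=ₛ (S ⊞ T ⊠ W ⊞ U ⊠ (W ⊠ W)) ⊠ F)
                  S.refl (const s) (const t) (const u) w (φ ∘ₛ w) ⟩
    quadratic s t u w ⊛ (φ ∘ₛ w)  ∎
    where open ≋-Reasoning

module FormalDerivative {c ℓ : Level} (K : Field c ℓ) where
  open Field K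
  open FieldOps K
  open FieldArithmetic K using (ofℕ-+)
  open FiniteSums K
  open SeriesRing K
  open IntegerCoefficients commutativeRing using (solve; _:=_; _:*_)

  𝔇 : Series → Series
  𝔇 f n = ofℕ (suc n) * f (suc n)

  𝔇-cong : ∀ {f g} → f ≋ g → 𝔇 f ≋ 𝔇 g
  𝔇-cong (mk≋ f≈g) = mk≋ (λ n → *-congˡ (f≈g (suc n)))

  𝔇-const : ∀ x → 𝔇 (const x) ≋ 0ₛ
  𝔇-const x = mk≋ (λ n → zeroʳ _)

  𝔇-Leibniz : ∀ f g → 𝔇 (f ⊛ g) ≋ 𝔇 f ⊛ g ⊕ f ⊛ 𝔇 g
  𝔇-Leibniz f g = mk≋ coefficientwise
    where
    open ≈-Reasoning
    coefficientwise : ∀ n → 𝔇 (f ⊛ g) n ≈ (𝔇 f ⊛ g ⊕ f ⊛ 𝔇 g) n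
    coefficientwise n = begin
      ofℕ (suc n) * sumTo (suc n) (λ i → f i * g (suc n ∸ i))
        ≈⟨ sumTo-distribˡ (suc n) _ _ ⟩
      sumTo (suc n) (λ i → ofℕ (suc n) * (f i * g (suc n ∸ i)))
        ≈⟨ sumTo-cong≤ (suc n) (λ i i≤ → trans (*-congʳ (split i i≤)) (distribʳ _ _ _)) ⟩
      sumTo (suc n) (λ i → ofℕ i * (f i * g (suc n ∸ i)) + ofℕ (suc n ∸ i) * (f i * g (suc n ∸ i)))
        ≈⟨ sumTo-distrib-+ (suc n) _ _ ⟩
      sumTo (suc n) (λ i → ofℕ i * (f i * g (suc n ∸ i))) + sumTo (suc n) (λ i → ofℕ (suc n ∸ i) * (f i * g (suc n ∸ i)))
        ≈⟨ +-cong left right ⟩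
      (𝔇 f ⊛ g) n + (f ⊛ 𝔇 g) n  ∎
      where
      split : ∀ i → i ≤ suc n → ofℕ (suc n) ≈ ofℕ i + ofℕ (suc n ∸ i)
      split i i≤ = trans (reflexive (≡.cong ofℕ (≡.sym (ℕ.m+[n∸m]≡n i≤)))) (ofℕ-+ i (suc n ∸ i))
      left : sumTo (suc n) (λ i → ofℕ i * (f i * g (suc n ∸ i))) ≈ (𝔇 f ⊛ g) n
      left = trans (sumTo-suc n _) (trans (+-congʳ (zeroˡ _)) (trans (+-identityˡ _)
               (sumTo-cong n (λ j → sym (*-assoc _ _ _)))))
      right : sumTo (suc n) (λ i → ofℕ (suc n ∸ i) * (f i * g (suc n ∸ i))) ≈ (f ⊛ 𝔇 g) n
      right = trans (+-congˡ (trans (*-congʳ (reflexive (≡.cong ofℕ (ℕ.n∸n≡0 n)))) (zeroˡ _)))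
                (trans (+-identityʳ _) (sumTo-cong≤ n (λ i i≤n →
                  trans (reflexive (≡.cong (λ t → ofℕ t * (f i * g t)) (ℕ.+-∸-assoc 1 i≤n)))
                        (solve 3 (λ a b c → a :* (b :* c) := b :* (a :* c)) refl _ _ _))))

module JacobiFractions {c ℓ : Level} (K : Field c ℓ) where
  open Field K
  open FieldOps K
  open SeriesRing K
  open IntegerCoefficients commutativeRing using (solve; _:=_; :-_; _:-_; con)

  denominator : (α β : ℕ → Carrier) → ℕ → Series → Series
  denominator α β k J = one ⊖ α k ·ₛ X ⊖ β k ·ₛ (X ⊛ X ⊛ J)

  denominator-cong : ∀ α β α′ β′ k k′ {J J′} → α k ≈ α′ k′ → β k ≈ β′ k′ → J ≋ J′ →
                     denominator α β k J ≋ denominator α′ β′ k′ J′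
  denominator-cong α β α′ β′ k k′ α≈ β≈ (mk≋ J≈J′) = mk≋ λ n →
    +-cong (+-congˡ (-‿cong (*-congʳ α≈))) (-‿cong (*-cong β≈ (⊛-cong (λ _ → refl) J≈J′ n)))

  denominator-cong≤ : ∀ α β k N {J J′} → (∀ j → suc (suc j) ≤ N → J j ≈ J′ j) →
                      denominator α β k J ≈[ N ] denominator α β k J′
  denominator-cong≤ α β k N {J} {J′} J≈J′ i i≤N = +-congˡ (-‿cong (*-congˡ (X²⊛-cong i i≤N)))
    where
    X²⊛-cong : (X ⊛ X ⊛ J) ≈[ N ] (X ⊛ X ⊛ J′)
    X²⊛-cong zero          _ = trans (X²⊛-zero J) (sym (X²⊛-zero J′))
    X²⊛-cong (suc zero)    _ = trans (X²⊛-one J) (sym (X²⊛-one J′))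
    X²⊛-cong (suc (suc j)) p = trans (X²⊛-suc-suc J j) (trans (J≈J′ j p) (sym (X²⊛-suc-suc J′ j)))

  denominator-zero : ∀ α β k J → denominator α β k J 0 ≈ 1#
  denominator-zero α β k J =
    trans (+-cong (+-congˡ (-‿cong (zeroʳ _))) (-‿cong (trans (*-congˡ (X²⊛-zero J)) (zeroʳ _))))
          (solve 1 (λ x → (x :- con (+ 0)) :- con (+ 0) := x) refl 1#)

  denominator-one : ∀ α β k J → denominator α β k J 1 ≈ - α k
  denominator-one α β k J =
    trans (+-cong (+-congˡ (-‿cong (*-identityʳ _))) (-‿cong (trans (*-congˡ (X²⊛-one J)) (zeroʳ _))))
          (solve 1 (λ a → (con (+ 0) :- a) :- con (+ 0) := :- a) refl (α k))

  denominator-suc-suc : ∀ α β k J n → denominator α β k J (suc (suc n)) ≈ - (β k * J n)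
  denominator-suc-suc α β k J n =
    trans (+-cong (+-congˡ (-‿cong (zeroʳ _))) (-‿cong (*-congˡ (X²⊛-suc-suc J n))))
          (solve 1 (λ y → (con (+ 0) :- con (+ 0)) :- y := :- y) refl (β k * J n))

  denominator≋ : ∀ α β k J → denominator α β k J ≋ one ⊖ const (α k) ⊛ X ⊖ const (β k) ⊛ (X ⊛ X ⊛ J)
  denominator≋ α β k J =
    S.+-cong (S.+-congˡ (S.-‿cong (·ₛ≋const⊛ (α k) X))) (S.-‿cong (·ₛ≋const⊛ (β k) (X ⊛ X ⊛ J)))

  constant-denominator≋ : ∀ α β k J {x y} → α k ≈ x → β k ≈ y → denominator α β k J ≋ one ⊖ const x ⊛ X ⊖ const y ⊛ (X ⊛ X ⊛ J)
  constant-denominator≋ α β k J α≈ β≈ = S.trans (denominator≋ α β k J)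
    (S.+-cong (S.+-congˡ (S.-‿cong (S.*-congʳ {X} (const-cong α≈)))) (S.-‿cong (S.*-congʳ {X ⊛ X ⊛ J} (const-cong β≈))))

  Jd-stable : ∀ α β d d′ k m → m < d → m < d′ → Jd d α β k m ≈ Jd d′ α β k m
  Jd-stable α β (suc d) (suc d′) k m (s≤s m<d) (s≤s m<d′) =
    inv1-cong≤ m (denominator-cong≤ α β k m (λ j j+2≤m →
      Jd-stable α β d d′ (suc k) j (below j+2≤m m<d) (below j+2≤m m<d′))) m ℕ.≤-refl
    where
    below : ∀ {j e} → suc (suc j) ≤ m → m ≤ e → j < e
    below j+2≤m m≤e = ℕ.≤-trans (ℕ.n≤1+n _) (ℕ.≤-trans j+2≤m m≤e)

  -- 𝒥-tail α β k is the continued fraction J(α_{k+1}, α_{k+2}, …; β_{k+1}, β_{k+2}, …).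
  𝒥-tail : (α β : ℕ → Carrier) → ℕ → Series
  𝒥-tail α β k n = Jd (suc n) α β k n

  𝒥-tail-unfold : ∀ α β k → 𝒥-tail α β k ≈ₛ inv1 (denominator α β k (𝒥-tail α β (suc k)))
  𝒥-tail-unfold α β k zero    = refl
  𝒥-tail-unfold α β k (suc n) = inv1-cong≤ (suc n) (denominator-cong≤ α β k (suc n) (λ j j+2≤n+1 →
    Jd-stable α β (suc n) (suc j) (suc k) j (ℕ.≤-trans (ℕ.≤-pred j+2≤n+1) (ℕ.n≤1+n n)) ℕ.≤-refl)) (suc n) ℕ.≤-refl

  𝒥-tail-equation : ∀ α β k → 𝒥-tail α β k ⊛ denominator α β k (𝒥-tail α β (suc k)) ≋ one
  𝒥-tail-equation α β k = S.trans (S.*-comm (𝒥-tail α β k) den) (S.trans (S.*-congˡ (mk≋ (𝒥-tail-unfold α β k)))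
    (inv1-inverse den (denominator-zero α β k (𝒥-tail α β (suc k)))))
    where den = denominator α β k (𝒥-tail α β (suc k))

  𝒥-tail-expansion : ∀ α β k → let M = 𝒥-tail α β k; N = 𝒥-tail α β (suc k) in
    M ≋ one ⊕ const (α k) ⊛ (X ⊛ M) ⊕ const (β k) ⊛ (X ⊛ X ⊛ (M ⊛ N))
  𝒥-tail-expansion α β k = begin
    M
      ≈⟨ solveₛ 5 (λ M N A B Y → M :=ₛ M ⊠ (conₛ (+ 1) ⊟ A ⊠ Y ⊟ B ⊠ (Y ⊠ Y ⊠ N)) ⊞ (A ⊠ (Y ⊠ M) ⊞ B ⊠ (Y ⊠ Y ⊠ (M ⊠ N))))
                  S.refl M N (const (α k)) (const (β k)) X ⟩
    M ⊛ (one ⊖ A ⊛ X ⊖ B ⊛ (X ⊛ X ⊛ N)) ⊕ rest  ≈⟨ S.+-congʳ (S.trans (S.*-congˡ (S.sym (denominator≋ α β k N))) (𝒥-tail-equation α β k)) ⟩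
    one ⊕ rest                                   ≈⟨ S.+-assoc one (A ⊛ (X ⊛ M)) (B ⊛ (X ⊛ X ⊛ (M ⊛ N))) ⟨
    one ⊕ A ⊛ (X ⊛ M) ⊕ B ⊛ (X ⊛ X ⊛ (M ⊛ N))   ∎
    where
    open ≋-Reasoning
    M = 𝒥-tail α β k
    N = 𝒥-tail α β (suc k)
    A = const (α k)
    B = const (β k)
    rest = A ⊛ (X ⊛ M) ⊕ B ⊛ (X ⊛ X ⊛ (M ⊛ N))

  𝒥-tail-shift-cong : ∀ α β α′ β′ k k′ → (∀ i → α (k ℕ.+ i) ≈ α′ (k′ ℕ.+ i)) → (∀ i → β (k ℕ.+ i) ≈ β′ (k′ ℕ.+ i)) →
                      𝒥-tail α β k ≋ 𝒥-tail α′ β′ k′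
  𝒥-tail-shift-cong α β α′ β′ k k′ α≈ β≈ = mk≋ (λ n → coeff (Jd-shift-cong (suc n) k k′ α≈ β≈) n)
    where
    Jd-shift-cong : ∀ d k k′ → (∀ i → α (k ℕ.+ i) ≈ α′ (k′ ℕ.+ i)) → (∀ i → β (k ℕ.+ i) ≈ β′ (k′ ℕ.+ i)) →
                    Jd d α β k ≋ Jd d α′ β′ k′
    Jd-shift-cong zero    k k′ α≈ β≈ = S.refl
    Jd-shift-cong (suc d) k k′ α≈ β≈ = inv1-cong (denominator-cong α β α′ β′ k k′ (first α α′ α≈) (first β β′ β≈)
                                                    (Jd-shift-cong d (suc k) (suc k′) (next α α′ α≈) (next β β′ β≈)))
      where
      first : ∀ (γ γ′ : ℕ → Carrier) → (∀ i → γ (k ℕ.+ i) ≈ γ′ (k′ ℕ.+ i)) → γ k ≈ γ′ k′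
      first γ γ′ γ≈ = ≡.subst₂ (λ s t → γ s ≈ γ′ t) (ℕ.+-identityʳ k) (ℕ.+-identityʳ k′) (γ≈ 0)
      next : ∀ (γ γ′ : ℕ → Carrier) → (∀ i → γ (k ℕ.+ i) ≈ γ′ (k′ ℕ.+ i)) → ∀ i → γ (suc k ℕ.+ i) ≈ γ′ (suc k′ ℕ.+ i)
      next γ γ′ γ≈ i = ≡.subst₂ (λ s t → γ s ≈ γ′ t) (ℕ.+-suc k i) (ℕ.+-suc k′ i) (γ≈ (suc i))

module ProductionMatrix {c ℓ : Level} (K : Field c ℓ) where
  open Field K
  open FieldOps K
  open SeriesRing K
  open JacobiFractions K

  -- The series M₀ ∏_{j≤k} γ_j x M_j, M_j the tails, obey the tridiagonal recurrence, so they are the columns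
  -- of every array that obeys it.
  module _ (α β γ δ : ℕ → Carrier) (β≈γδ : ∀ k → β k ≈ γ (suc k) * δ k) where

    M : ℕ → Series
    M = 𝒥-tail α β

    column : ℕ → Series
    column zero    = M 0
    column (suc k) = column k ⊛ (const (γ (suc k)) ⊛ (X ⊛ M (suc k)))

    β-split : ∀ k → const (β k) ≋ const (γ (suc k)) ⊛ const (δ k)
    β-split k = S.trans (const-cong (β≈γδ k)) (const-* (γ (suc k)) (δ k))

    column-zero-equation : column 0 ≋ one ⊕ const (α 0) ⊛ (X ⊛ column 0) ⊕ const (δ 0) ⊛ (X ⊛ column 1)
    column-zero-equation = begin
      M 0
        ≈⟨ 𝒥-tail-expansion α β 0 ⟩
      one ⊕ const (α 0) ⊛ (X ⊛ M 0) ⊕ const (β 0) ⊛ (X ⊛ X ⊛ (M 0 ⊛ M 1))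
        ≈⟨ S.+-congˡ (S.*-congʳ {X ⊛ X ⊛ (M 0 ⊛ M 1)} (β-split 0)) ⟩
      one ⊕ const (α 0) ⊛ (X ⊛ M 0) ⊕ (const (γ 1) ⊛ const (δ 0)) ⊛ (X ⊛ X ⊛ (M 0 ⊛ M 1))
        ≈⟨ solveₛ 6 (λ M₀ M₁ A G D Y → conₛ (+ 1) ⊞ A ⊠ (Y ⊠ M₀) ⊞ (G ⊠ D) ⊠ (Y ⊠ Y ⊠ (M₀ ⊠ M₁))
                                        :=ₛ conₛ (+ 1) ⊞ A ⊠ (Y ⊠ M₀) ⊞ D ⊠ (Y ⊠ (M₀ ⊠ (G ⊠ (Y ⊠ M₁)))))
                    S.refl (M 0) (M 1) (const (α 0)) (const (γ 1)) (const (δ 0)) X ⟩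
      one ⊕ const (α 0) ⊛ (X ⊛ column 0) ⊕ const (δ 0) ⊛ (X ⊛ column 1)  ∎
      where open ≋-Reasoning

    column-suc-equation : ∀ k → column (suc k) ≋
      const (γ (suc k)) ⊛ (X ⊛ column k) ⊕ const (α (suc k)) ⊛ (X ⊛ column (suc k)) ⊕ const (δ (suc k)) ⊛ (X ⊛ column (suc (suc k)))
    column-suc-equation k = begin
      C ⊛ (G ⊛ (X ⊛ M′))
        ≈⟨ S.*-congˡ (S.*-congˡ (S.*-congˡ (𝒥-tail-expansion α β (suc k)))) ⟩
      C ⊛ (G ⊛ (X ⊛ (one ⊕ A ⊛ (X ⊛ M′) ⊕ const (β (suc k)) ⊛ (X ⊛ X ⊛ (M′ ⊛ M″)))))
        ≈⟨ S.*-congˡ (S.*-congˡ (S.*-congˡ (S.+-congˡ {one ⊕ A ⊛ (X ⊛ M′)} (S.*-congʳ {X ⊛ X ⊛ (M′ ⊛ M″)} (β-split (suc k)))))) ⟩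
      C ⊛ (G ⊛ (X ⊛ (one ⊕ A ⊛ (X ⊛ M′) ⊕ (G′ ⊛ D) ⊛ (X ⊛ X ⊛ (M′ ⊛ M″)))))
        ≈⟨ solveₛ 8 (λ C M′ M″ G G′ A D Y →
                       C ⊠ (G ⊠ (Y ⊠ (conₛ (+ 1) ⊞ A ⊠ (Y ⊠ M′) ⊞ (G′ ⊠ D) ⊠ (Y ⊠ Y ⊠ (M′ ⊠ M″)))))
                   :=ₛ G ⊠ (Y ⊠ C) ⊞ A ⊠ (Y ⊠ (C ⊠ (G ⊠ (Y ⊠ M′)))) ⊞ D ⊠ (Y ⊠ ((C ⊠ (G ⊠ (Y ⊠ M′))) ⊠ (G′ ⊠ (Y ⊠ M″)))))
                    S.refl C M′ M″ G G′ A D X ⟩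
      G ⊛ (X ⊛ C) ⊕ A ⊛ (X ⊛ column (suc k)) ⊕ D ⊛ (X ⊛ column (suc (suc k)))  ∎
      where
      open ≋-Reasoning
      C = column k
      M′ = M (suc k)
      M″ = M (suc (suc k))
      G = const (γ (suc k))
      G′ = const (γ (suc (suc k)))
      A = const (α (suc k))
      D = const (δ (suc k))

    column-suc-zero : ∀ k → column (suc k) 0 ≈ 0#
    column-suc-zero k = trans (*-congˡ (trans (*-congˡ (X⊛-zero (M (suc k)))) (zeroʳ _))) (zeroʳ _)

    first-column : (L : ℕ → ℕ → Carrier) → L 0 0 ≈ 1# → (∀ k → L 0 (suc k) ≈ 0#) →
                   (∀ n → L (suc n) 0 ≈ α 0 * L n 0 + δ 0 * L n 1) →
                   (∀ n k → L (suc n) (suc k) ≈ γ (suc k) * L n k + α (suc k) * L n (suc k) + δ (suc k) * L n (suc (suc k))) →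
                   ∀ n → L n 0 ≈ 𝒥 α β n
    first-column L L₀₀ L₀ₛ Lₛ₀ Lₛₛ n = L≈column n 0
      where
      L≈column : ∀ n k → L n k ≈ column k n
      L≈column zero    zero    = L₀₀
      L≈column zero    (suc k) = trans (L₀ₛ k) (sym (column-suc-zero k))
      L≈column (suc n) zero    = begin
        L (suc n) 0                                          ≈⟨ Lₛ₀ n ⟩
        α 0 * L n 0 + δ 0 * L n 1                            ≈⟨ +-cong (*-congˡ (L≈column n 0)) (*-congˡ (L≈column n 1)) ⟩
        α 0 * column 0 n + δ 0 * column 1 n                  ≈⟨ +-cong (+-identityˡ _) refl ⟨
        0# + α 0 * column 0 n + δ 0 * column 1 n             ≈⟨ +-cong (+-congˡ (const⊛X⊛-suc (α 0) (column 0) n)) (const⊛X⊛-suc (δ 0) (column 1) n) ⟨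
        (one ⊕ const (α 0) ⊛ (X ⊛ column 0) ⊕ const (δ 0) ⊛ (X ⊛ column 1)) (suc n)  ≈⟨ coeff column-zero-equation (suc n) ⟨
        column 0 (suc n)                                     ∎
        where open ≈-Reasoning
      L≈column (suc n) (suc k) = begin
        L (suc n) (suc k)
          ≈⟨ Lₛₛ n k ⟩
        γ (suc k) * L n k + α (suc k) * L n (suc k) + δ (suc k) * L n (suc (suc k))
          ≈⟨ +-cong (+-cong (*-congˡ (L≈column n k)) (*-congˡ (L≈column n (suc k)))) (*-congˡ (L≈column n (suc (suc k)))) ⟩
        γ (suc k) * column k n + α (suc k) * column (suc k) n + δ (suc k) * column (suc (suc k)) n
          ≈⟨ +-cong (+-cong (const⊛X⊛-suc _ (column k) n) (const⊛X⊛-suc _ (column (suc k)) n)) (const⊛X⊛-suc _ (column (suc (suc k))) n) ⟨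
        (const (γ (suc k)) ⊛ (X ⊛ column k) ⊕ const (α (suc k)) ⊛ (X ⊛ column (suc k)) ⊕ const (δ (suc k)) ⊛ (X ⊛ column (suc (suc k)))) (suc n)
          ≈⟨ coeff (column-suc-equation k) (suc n) ⟨
        column (suc k) (suc n)  ∎
        where open ≈-Reasoning

module WeightedUniqueness {c ℓ : Level} (K : Field c ℓ) where
  open Field K
  open FieldOps K
  open SeriesRing K
  open JacobiFractions K
  open IntegerCoefficients commutativeRing using (solve; _:=_; _:*_; :-_; _:-_)

  weight : (ℕ → Carrier) → ℕ → Carrier
  weight β zero    = 1#
  weight β (suc k) = weight β k * β k

  -- J(α;β) sees α_k and β_k only through β₀⋯β_{k-1} times them: below a vanishing β the fraction is cut off.
  record WeightedAgree (α β α′ β′ : ℕ → Carrier) (k : ℕ) : Set ℓ where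
    field
      α-agree : weight β k * α k ≈ weight β k * α′ k
      β-agree : weight β k * β k ≈ weight β k * β′ k
  open WeightedAgree

  scaled-denominator≋ : ∀ e α β k J →
    const e ⊛ denominator α β k J ≋ const e ⊖ const (e * α k) ⊛ X ⊖ (X ⊛ X) ⊛ (const (e * β k) ⊛ J)
  scaled-denominator≋ e α β k J = begin
    const e ⊛ denominator α β k J
      ≈⟨ S.*-congˡ (denominator≋ α β k J) ⟩
    const e ⊛ (one ⊖ const (α k) ⊛ X ⊖ const (β k) ⊛ (X ⊛ X ⊛ J))
      ≈⟨ solveₛ 5 (λ E A B Y J → E ⊠ (conₛ (+ 1) ⊟ A ⊠ Y ⊟ B ⊠ (Y ⊠ Y ⊠ J)) :=ₛ E ⊟ (E ⊠ A) ⊠ Y ⊟ (Y ⊠ Y) ⊠ ((E ⊠ B) ⊠ J))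
                  S.refl (const e) (const (α k)) (const (β k)) X J ⟩
    const e ⊖ (const e ⊛ const (α k)) ⊛ X ⊖ (X ⊛ X) ⊛ ((const e ⊛ const (β k)) ⊛ J)
      ≈⟨ S.+-cong (S.+-congˡ (S.-‿cong (S.*-congʳ {X} (const-* e (α k))))) (S.-‿cong (S.*-congˡ (S.*-congʳ {J} (const-* e (β k))))) ⟨
    const e ⊖ const (e * α k) ⊛ X ⊖ (X ⊛ X) ⊛ (const (e * β k) ⊛ J)  ∎
    where open ≋-Reasoning

  scaled-denominator-cong : ∀ e α β α′ β′ k J J′ → e * α k ≈ e * α′ k → const (e * β k) ⊛ J ≋ const (e * β′ k) ⊛ J′ →
                            const e ⊛ denominator α β k J ≋ const e ⊛ denominator α′ β′ k J′
  scaled-denominator-cong e α β α′ β′ k J J′ α≈ βJ≈ = begin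
    const e ⊛ denominator α β k J
      ≈⟨ scaled-denominator≋ e α β k J ⟩
    const e ⊖ const (e * α k) ⊛ X ⊖ (X ⊛ X) ⊛ (const (e * β k) ⊛ J)
      ≈⟨ S.+-cong (S.+-congˡ (S.-‿cong (S.*-congʳ {X} (const-cong α≈)))) (S.-‿cong (S.*-congˡ βJ≈)) ⟩
    const e ⊖ const (e * α′ k) ⊛ X ⊖ (X ⊛ X) ⊛ (const (e * β′ k) ⊛ J′)
      ≈⟨ scaled-denominator≋ e α′ β′ k J′ ⟨
    const e ⊛ denominator α′ β′ k J′  ∎
    where open ≋-Reasoning

  scaled-denominator-coefficients : ∀ e α β α′ β′ k J J′ →
    const e ⊛ denominator α β k J ≋ const e ⊛ denominator α′ β′ k J′ →
    e * α k ≈ e * α′ k × (∀ n → (e * β k) * J n ≈ (e * β′ k) * J′ n)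
  scaled-denominator-coefficients e α β α′ β′ k J J′ (mk≋ den≈den′) =
      cancel-neg (trans (*-congˡ (sym (denominator-one α β k J))) (trans (at 1)
                 (*-congˡ (denominator-one α′ β′ k J′))))
    , λ n → trans (*-assoc _ _ _) (trans (cancel-neg (trans (*-congˡ (sym (denominator-suc-suc α β k J n)))
              (trans (at (suc (suc n))) (*-congˡ (denominator-suc-suc α′ β′ k J′ n))))) (sym (*-assoc _ _ _)))
    where
    at : ∀ n → e * denominator α β k J n ≈ e * denominator α′ β′ k J′ n
    at n = trans (sym (const⊛ e (denominator α β k J) n)) (trans (den≈den′ n) (const⊛ e (denominator α′ β′ k J′) n))
    cancel-neg : ∀ {x y} → e * - x ≈ e * - y → e * x ≈ e * y
    cancel-neg {x} {y} e-x≈e-y = trans (solve 2 (λ e x → e :* x := :- (e :* (:- x))) refl e x)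
      (trans (-‿cong e-x≈e-y) (solve 2 (λ e y → :- (e :* (:- y)) := e :* y) refl e y))

  module _ {α β α′ β′ : ℕ → Carrier} (𝒥≈𝒥′ : 𝒥 α β ≈ₛ 𝒥 α′ β′) where

    scaled-tails : ∀ k → const (weight β k) ⊛ 𝒥-tail α β k ≋ const (weight β k) ⊛ 𝒥-tail α′ β′ k
    scaled-denominators : ∀ k →
      const (weight β k) ⊛ denominator α β k (𝒥-tail α β (suc k)) ≋ const (weight β k) ⊛ denominator α′ β′ k (𝒥-tail α′ β′ (suc k))

    scaled-denominators k =
      scaled-inverses-agree {𝒥-tail α β k} {denominator α β k (𝒥-tail α β (suc k))}
                        {𝒥-tail α′ β′ k} {denominator α′ β′ k (𝒥-tail α′ β′ (suc k))}
                        (const (weight β k)) (𝒥-tail-equation α β k) (𝒥-tail-equation α′ β′ k) (scaled-tails k)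

    scaled-tails zero    = S.*-congˡ (mk≋ 𝒥≈𝒥′)
    scaled-tails (suc k) = mk≋ λ n → begin
      (const (w * β k) ⊛ M) n     ≈⟨ const⊛ (w * β k) M n ⟩
      (w * β k) * M n             ≈⟨ proj₂ coefficients n ⟩
      (w * β′ k) * M′ n           ≈⟨ *-congʳ (trans (sym (*-identityʳ _)) (trans (sym (proj₂ coefficients 0)) (*-identityʳ _))) ⟩
      (w * β k) * M′ n            ≈⟨ const⊛ (w * β k) M′ n ⟨
      (const (w * β k) ⊛ M′) n    ∎
      where
      open ≈-Reasoning
      w = weight β k
      M = 𝒥-tail α β (suc k)
      M′ = 𝒥-tail α′ β′ (suc k)
      coefficients = scaled-denominator-coefficients w α β α′ β′ k M M′ (scaled-denominators k)

    𝒥-weighted-agree : ∀ k → WeightedAgree α β α′ β′ k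
    𝒥-weighted-agree k = record
      { α-agree = proj₁ coefficients
      ; β-agree = trans (sym (*-identityʳ _)) (trans (proj₂ coefficients 0) (*-identityʳ _)) }
      where coefficients = scaled-denominator-coefficients (weight β k) α β α′ β′ k
                             (𝒥-tail α β (suc k)) (𝒥-tail α′ β′ (suc k)) (scaled-denominators k)

  𝒥-cong-weighted : ∀ {α β α′ β′} → (∀ k → WeightedAgree α β α′ β′ k) → 𝒥 α β ≈ₛ 𝒥 α′ β′
  𝒥-cong-weighted {α} {β} {α′} {β′} agree n = begin
    Jd (suc n) α β 0 n           ≈⟨ coeff (S.*-identityˡ (Jd (suc n) α β 0)) n ⟨
    (one ⊛ Jd (suc n) α β 0) n   ≈⟨ coeff (scaled-Jd (suc n) 0) n ⟩
    (one ⊛ Jd (suc n) α′ β′ 0) n ≈⟨ coeff (S.*-identityˡ (Jd (suc n) α′ β′ 0)) n ⟩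
    Jd (suc n) α′ β′ 0 n         ∎
    where
    open ≈-Reasoning
    scaled-Jd : ∀ d k → const (weight β k) ⊛ Jd d α β k ≋ const (weight β k) ⊛ Jd d α′ β′ k
    scaled-Jd zero    k = S.refl
    scaled-Jd (suc d) k = scaled-inverses-agree {den} {inv1 den} {den′} {inv1 den′} (const (weight β k))
      (inv1-inverse den (denominator-zero α β k J)) (inv1-inverse den′ (denominator-zero α′ β′ k J′))
      (scaled-denominator-cong (weight β k) α β α′ β′ k J J′ (α-agree (agree k))
        (S.trans (scaled-Jd d (suc k)) (S.*-congʳ {J′} (const-cong (β-agree (agree k))))))
      where
      J = Jd d α β (suc k)
      J′ = Jd d α′ β′ (suc k)
      den = denominator α β k J
      den′ = denominator α′ β′ k J′

  weight-* : ∀ β γ k → weight (λ j → β j * γ j) k ≈ weight β k * weight γ k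
  weight-* β γ zero    = sym (*-identityʳ 1#)
  weight-* β γ (suc k) = trans (*-congʳ (weight-* β γ k))
    (solve 4 (λ u v b g → (u :* v) :* (b :* g) := (u :* b) :* (v :* g)) refl (weight β k) (weight γ k) (β k) (γ k))

  module _ (ch : CharZero) where

    𝕋-weighted-agree : ∀ {α β α′ β′} → (∀ k → WeightedAgree α β α′ β′ k) →
                       ∀ k → WeightedAgree (Tα α) (Tβ ch β) (Tα α′) (Tβ ch β′) k
    𝕋-weighted-agree {α} {β} {α′} {β′} agree k = record { α-agree = Tα-agree k ; β-agree = Tβ-agree }
      where
      open ≈-Reasoning
      ι : ℕ → Carrier
      ι j = invℕ ch (suc j ℕ.* suc j)
      rescale : ∀ {x y} j → weight β j * x ≈ weight β j * y → weight (Tβ ch β) j * x ≈ weight (Tβ ch β) j * y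
      rescale {x} {y} j agree-j = begin
        weight (Tβ ch β) j * x       ≈⟨ *-congʳ (weight-* β ι j) ⟩
        (weight β j * weight ι j) * x  ≈⟨ solve 3 (λ e s x → (e :* s) :* x := s :* (e :* x)) refl (weight β j) (weight ι j) x ⟩
        weight ι j * (weight β j * x)  ≈⟨ *-congˡ agree-j ⟩
        weight ι j * (weight β j * y)  ≈⟨ solve 3 (λ e s y → s :* (e :* y) := (e :* s) :* y) refl (weight β j) (weight ι j) y ⟩
        (weight β j * weight ι j) * y  ≈⟨ *-congʳ (weight-* β ι j) ⟨
        weight (Tβ ch β) j * y       ∎
      Tβ-agree : weight (Tβ ch β) k * (β k * ι k) ≈ weight (Tβ ch β) k * (β′ k * ι k)
      Tβ-agree = rescale k (trans (sym (*-assoc _ _ _)) (trans (*-congʳ (β-agree (agree k))) (*-assoc _ _ _)))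
      Tα-agree : ∀ k → weight (Tβ ch β) k * Tα α k ≈ weight (Tβ ch β) k * Tα α′ k
      Tα-agree zero    = α-agree (agree 0)
      Tα-agree (suc k) = rescale (suc k) (begin
        (e * b) * (α (suc k) - α k)        ≈⟨ difference (α (suc k)) (α k) ⟩
        (e * b) * α (suc k) - b * (e * α k)  ≈⟨ +-cong (α-agree (agree (suc k))) (-‿cong (*-congˡ (α-agree (agree k)))) ⟩
        (e * b) * α′ (suc k) - b * (e * α′ k)  ≈⟨ difference (α′ (suc k)) (α′ k) ⟨
        (e * b) * (α′ (suc k) - α′ k)      ∎)
        where
        e = weight β k
        b = β k
        difference : ∀ x y → (e * b) * (x - y) ≈ (e * b) * x - b * (e * y)
        difference x y = solve 4 (λ e b x y → (e :* b) :* (x :- y) := (e :* b) :* x :- b :* (e :* y)) refl e b x y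

    𝕋-cong : ∀ {α β α′ β′} → 𝒥 α β ≈ₛ 𝒥 α′ β′ → 𝕋 ch α β ≈ₛ 𝕋 ch α′ β′
    𝕋-cong 𝒥≈𝒥′ = 𝒥-cong-weighted (𝕋-weighted-agree (𝒥-weighted-agree 𝒥≈𝒥′))

module ReversionIdentity {c ℓ : Level} (R : CommutativeRing c ℓ) where
  open CommutativeRing R
  open IntegerCoefficients R
  open SetoidReasoning setoid

  tails-solve-quadratic : ∀ a b c x T H → let p = b - a; q = b - a - a; r = a * a - a * b + c in
    T * (1# - p * x - r * (x * x * H)) ≈ 1# → H * (1# - q * x - r * (x * x * H)) ≈ 1# →
    (x * T) * (1# + a * (x * T)) ≈ x * (1# + b * (x * T) + c * ((x * T) * (x * T)))
  tails-solve-quadratic a b c x T H T-equation H-equation = begin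
    (x * T) * (1# + a * (x * T))
      ≈⟨ solve 6 (λ a b c x T H → let r = a :* a :- a :* b :+ c; w = x :* T
                                      e₁ = T :* (con (+ 1) :- (b :- a) :* x :- r :* (x :* x :* H)) :- con (+ 1)
                                      e₂ = H :* (con (+ 1) :- (b :- a :- a) :* x :- r :* (x :* x :* H)) :- con (+ 1) in
                   w :* (con (+ 1) :+ a :* w)
                := x :* (e₁ :* (con (+ 1) :+ a :* w) :+ r :* (x :* x) :* T :* (T :* e₂ :- H :* e₁))
                   :+ x :* (con (+ 1) :+ b :* w :+ c :* (w :* w)))
                 refl a b c x T H ⟩
    error (T * Z₁ - 1#) (H * Z₂ - 1#) + rhs
      ≈⟨ +-congʳ (error-cong (vanishes T-equation) (vanishes H-equation)) ⟩
    error 0# 0# + rhs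
      ≈⟨ solve 7 (λ a r x T H w v → x :* (con (+ 0) :* (con (+ 1) :+ a :* w) :+ r :* (x :* x) :* T :* (T :* con (+ 0) :- H :* con (+ 0))) :+ v := v)
               refl a r x T H (x * T) rhs ⟩
    rhs  ∎
    where
    r = a * a - a * b + c
    Z₁ = 1# - (b - a) * x - r * (x * x * H)
    Z₂ = 1# - (b - a - a) * x - r * (x * x * H)
    rhs = x * (1# + b * (x * T) + c * ((x * T) * (x * T)))
    error : Carrier → Carrier → Carrier
    error e₁ e₂ = x * (e₁ * (1# + a * (x * T)) + r * (x * x) * T * (T * e₂ - H * e₁))
    error-cong : ∀ {e₁ e₁′ e₂ e₂′} → e₁ ≈ e₁′ → e₂ ≈ e₂′ → error e₁ e₂ ≈ error e₁′ e₂′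
    error-cong e₁≈ e₂≈ = *-congˡ (+-cong (*-congʳ e₁≈) (*-congˡ (+-cong (*-congˡ e₂≈) (-‿cong (*-congˡ e₁≈)))))
    vanishes : ∀ {y} → y ≈ 1# → y - 1# ≈ 0#
    vanishes y≈1 = trans (+-congʳ y≈1) (-‿inverseʳ 1#)

module Example {c ℓ : Level} (K : Field c ℓ) (ch : FieldOps.CharZero K) (a b c′ : Field.Carrier K) where
  open Field K
  open FieldOps K
  open SeriesRing K
  open JacobiFractions K
  open Composition K
  open FormalDerivative K
  open FieldArithmetic K using (ofℕ-*; inverse-unique)
  open IntegerCoefficients commutativeRing using (solve; _:=_; _:+_; _:*_; :-_; _:-_; con)

  p q r : Carrier
  p = b - a
  q = b - a - a
  r = a * a - a * b + c′

  -- Chosen so that 𝕋 has the constant coefficients p, q, q, … and r, r, …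
  αs βs : ℕ → Carrier
  αs k = p + ofℕ k * q
  βs k = r * ofℕ (suc k ℕ.* suc k)

  A B C P Q R : Series
  A = const a
  B = const b
  C = const c′
  P = const p
  Q = const q
  R = const r

  P≋B-A : P ≋ B ⊖ A
  P≋B-A = S.trans (const-+ b (- a)) (S.+-congˡ (const-neg a))

  Q≋P-A : Q ≋ P ⊖ A
  Q≋P-A = S.trans (const-+ p (- a)) (S.+-congˡ (const-neg a))

  R≋AA-AB+C : R ≋ A ⊛ A ⊖ A ⊛ B ⊕ C
  R≋AA-AB+C = S.trans (const-+ _ c′) (S.+-congʳ (S.trans (const-+ _ _)
                (S.+-cong (const-* a a) (S.trans (const-neg _) (S.-‿cong (const-* a b))))))

  g : Series
  g = gSeries a b c′

  T H : Series
  T = 𝕋 ch αs βs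
  H = 𝒥-tail (Tα αs) (Tβ ch βs) 1

  Tα-zero : Tα αs 0 ≈ p
  Tα-zero = solve 2 (λ p q → p :+ con (+ 0) :* q := p) refl p q

  Tα-suc : ∀ k → Tα αs (suc k) ≈ q
  Tα-suc k = solve 3 (λ p q n → (p :+ (con (+ 1) :+ n) :* q) :- (p :+ n :* q) := q) refl p q (ofℕ k)

  Tβ≈r : ∀ k → Tβ ch βs k ≈ r
  Tβ≈r k = trans (*-assoc _ _ _) (trans (*-congˡ (inverse _ _)) (*-identityʳ _))

  T-equation : T ⊛ (one ⊖ (B ⊖ A) ⊛ X ⊖ (A ⊛ A ⊖ A ⊛ B ⊕ C) ⊛ (X ⊛ X ⊛ H)) ≋ one
  T-equation = S.trans
    (S.*-congˡ (S.sym (S.trans (constant-denominator≋ (Tα αs) (Tβ ch βs) 0 H Tα-zero (Tβ≈r 0))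
      (S.+-cong (S.+-congˡ (S.-‿cong (S.*-congʳ {X} P≋B-A))) (S.-‿cong (S.*-congʳ {X ⊛ X ⊛ H} R≋AA-AB+C))))))
    (𝒥-tail-equation (Tα αs) (Tβ ch βs) 0)

  H-equation : H ⊛ (one ⊖ (B ⊖ A ⊖ A) ⊛ X ⊖ (A ⊛ A ⊖ A ⊛ B ⊕ C) ⊛ (X ⊛ X ⊛ H)) ≋ one
  H-equation = S.trans
    (S.*-congˡ (S.sym (S.trans (constant-denominator≋ (Tα αs) (Tβ ch βs) 1 (𝒥-tail (Tα αs) (Tβ ch βs) 2) (Tα-suc 0) (Tβ≈r 1))
      (S.+-cong (S.+-congˡ (S.-‿cong (S.*-congʳ {X} (S.trans Q≋P-A (S.+-congʳ P≋B-A)))))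
                (S.-‿cong (S.*-cong R≋AA-AB+C (S.*-congˡ {X ⊛ X} tail₂≋tail₁)))))))
    (𝒥-tail-equation (Tα αs) (Tβ ch βs) 1)
    where
    tail₂≋tail₁ : 𝒥-tail (Tα αs) (Tβ ch βs) 2 ≋ H
    tail₂≋tail₁ = 𝒥-tail-shift-cong _ _ _ _ 2 1 (λ i → trans (Tα-suc (suc i)) (sym (Tα-suc i)))
                                                (λ i → trans (Tβ≈r (2 ℕ.+ i)) (sym (Tβ≈r (1 ℕ.+ i))))

  w : Series
  w = X ⊛ T

  w-quadratic : w ⊛ (one ⊕ A ⊛ w) ≋ X ⊛ quadratic 1# b c′ w
  w-quadratic = ReversionIdentity.tails-solve-quadratic seriesRing A B C X T H T-equation H-equation

  D : Series
  D = one ⊕ b ·ₛ X ⊕ c′ ·ₛ (X ⊛ X)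

  D₀≈1 : D 0 ≈ 1#
  D₀≈1 = trans (+-cong (+-congˡ (zeroʳ b)) (trans (*-congˡ (X⊛-zero X)) (zeroʳ c′)))
               (trans (+-identityʳ _) (+-identityʳ _))

  D≋quadratic : D ≋ quadratic 1# b c′ X
  D≋quadratic = S.+-cong (S.+-congˡ (·ₛ≋const⊛ b X)) (·ₛ≋const⊛ c′ (X ⊛ X))

  quadratic⊛g : quadratic 1# b c′ X ⊛ g ≋ one ⊕ A ⊛ X
  quadratic⊛g = begin
    quadratic 1# b c′ X ⊛ ((one ⊕ a ·ₛ X) ⊛ inv1 D)  ≈⟨ S.*-congʳ {g} (S.sym D≋quadratic) ⟩
    D ⊛ ((one ⊕ a ·ₛ X) ⊛ inv1 D)                    ≈⟨ solveₛ 3 (λ D N E → D ⊠ (N ⊠ E) :=ₛ N ⊠ (D ⊠ E)) S.refl D (one ⊕ a ·ₛ X) (inv1 D) ⟩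
    (one ⊕ a ·ₛ X) ⊛ (D ⊛ inv1 D)                    ≈⟨ S.*-cong (S.+-congˡ (·ₛ≋const⊛ a X)) (inv1-inverse D D₀≈1) ⟩
    (one ⊕ A ⊛ X) ⊛ one                              ≈⟨ S.*-identityʳ (one ⊕ A ⊛ X) ⟩
    one ⊕ A ⊛ X                                      ∎
    where open ≋-Reasoning

  w₀≈0 : w 0 ≈ 0#
  w₀≈0 = X⊛-zero T

  reversion : (X ⊛ g) ∘ₛ w ≋ X
  reversion = ⊛-cancelˡ-unit (quadratic 1# b c′ w) Qw₀≈1 (begin
    quadratic 1# b c′ w ⊛ ((X ⊛ g) ∘ₛ w)          ≈⟨ ∘ₛ-quadratic⊛ 1# b c′ (X ⊛ g) w w₀≈0 ⟨
    (quadratic 1# b c′ X ⊛ (X ⊛ g)) ∘ₛ w          ≈⟨ ∘ₛ-congˡ w x-times-numerator ⟩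
    (quadratic 0# 1# a X ⊛ one) ∘ₛ w              ≈⟨ ∘ₛ-quadratic⊛ 0# 1# a one w w₀≈0 ⟩
    quadratic 0# 1# a w ⊛ (one ∘ₛ w)              ≈⟨ S.*-cong (S.+-congʳ (S.+-congʳ const-0≋0ₛ)) (∘ₛ-one w) ⟩
    (0ₛ ⊕ one ⊛ w ⊕ A ⊛ (w ⊛ w)) ⊛ one            ≈⟨ solveₛ 2 (λ W A → (conₛ (+ 0) ⊞ conₛ (+ 1) ⊠ W ⊞ A ⊠ (W ⊠ W)) ⊠ conₛ (+ 1)
                                                                 :=ₛ W ⊠ (conₛ (+ 1) ⊞ A ⊠ W)) S.refl w A ⟩
    w ⊛ (one ⊕ A ⊛ w)                             ≈⟨ w-quadratic ⟩
    X ⊛ quadratic 1# b c′ w                       ≈⟨ S.*-comm X (quadratic 1# b c′ w) ⟩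
    quadratic 1# b c′ w ⊛ X                       ∎)
    where
    open ≋-Reasoning
    Qw₀≈1 : quadratic 1# b c′ w 0 ≈ 1#
    Qw₀≈1 = trans (+-cong (+-congˡ (trans (const⊛ b w 0) (trans (*-congˡ w₀≈0) (zeroʳ b))))
                         (trans (const⊛ c′ (w ⊛ w) 0) (trans (*-congˡ (trans (*-congʳ w₀≈0) (zeroˡ _))) (zeroʳ c′))))
                  (trans (+-identityʳ _) (+-identityʳ _))
    x-times-numerator : quadratic 1# b c′ X ⊛ (X ⊛ g) ≋ quadratic 0# 1# a X ⊛ one
    x-times-numerator = begin
      quadratic 1# b c′ X ⊛ (X ⊛ g)  ≈⟨ solveₛ 3 (λ Q Y G → Q ⊠ (Y ⊠ G) :=ₛ Y ⊠ (Q ⊠ G)) S.refl (quadratic 1# b c′ X) X g ⟩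
      X ⊛ (quadratic 1# b c′ X ⊛ g)  ≈⟨ S.*-congˡ quadratic⊛g ⟩
      X ⊛ (one ⊕ A ⊛ X)              ≈⟨ solveₛ 2 (λ Y A → Y ⊠ (conₛ (+ 1) ⊞ A ⊠ Y) :=ₛ (conₛ (+ 0) ⊞ conₛ (+ 1) ⊠ Y ⊞ A ⊠ (Y ⊠ Y)) ⊠ conₛ (+ 1)) S.refl X A ⟩
      (0ₛ ⊕ one ⊛ X ⊕ A ⊛ (X ⊛ X)) ⊛ one  ≈⟨ S.*-congʳ {one} (S.+-congʳ (S.+-congʳ (S.sym const-0≋0ₛ))) ⟩
      quadratic 0# 1# a X ⊛ one      ∎

  g-reverts-𝕋 : IsRev g T
  g-reverts-𝕋 = coeff reversion

  I κ : Series
  I = inv1 D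
  κ = X ⊛ I

  g-form : g ≋ (one ⊕ A ⊛ X) ⊛ I
  g-form = S.*-congʳ {I} (S.+-congˡ (·ₛ≋const⊛ a X))

  g₀≈1 : g 0 ≈ 1#
  g₀≈1 = trans (*-identityʳ _) (trans (+-congˡ (zeroʳ a)) (+-identityʳ 1#))

  g≋I+Aκ : g ≋ I ⊕ A ⊛ κ
  g≋I+Aκ = S.trans g-form (solveₛ 3 (λ Y I A → (conₛ (+ 1) ⊞ A ⊠ Y) ⊠ I :=ₛ I ⊞ A ⊠ (Y ⊠ I)) S.refl X I A)

  -- (1 + p x) g + r x² I = (1 + b x + c x²) I, since p + a = b and p a + r = c.
  g-recurrence : g ⊕ P ⊛ (X ⊛ g) ⊕ R ⊛ (X ⊛ κ) ≋ one
  g-recurrence = begin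
    g ⊕ P ⊛ (X ⊛ g) ⊕ R ⊛ (X ⊛ κ)
      ≈⟨ S.+-cong (S.+-cong g-form (S.*-cong P≋B-A (S.*-congˡ g-form))) (S.*-congʳ {X ⊛ κ} R≋AA-AB+C) ⟩
    G ⊕ (B ⊖ A) ⊛ (X ⊛ G) ⊕ (A ⊛ A ⊖ A ⊛ B ⊕ C) ⊛ (X ⊛ κ)
      ≈⟨ solveₛ 5 (λ Y I A B C → let G = (conₛ (+ 1) ⊞ A ⊠ Y) ⊠ I in
                     G ⊞ (B ⊟ A) ⊠ (Y ⊠ G) ⊞ (A ⊠ A ⊟ A ⊠ B ⊞ C) ⊠ (Y ⊠ (Y ⊠ I)) :=ₛ (conₛ (+ 1) ⊞ B ⊠ Y ⊞ C ⊠ (Y ⊠ Y)) ⊠ I)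
                  S.refl X I A B C ⟩
    quadratic 1# b c′ X ⊛ I
      ≈⟨ S.*-congʳ {I} (S.sym D≋quadratic) ⟩
    D ⊛ I
      ≈⟨ inv1-inverse D D₀≈1 ⟩
    one  ∎
    where
    open ≋-Reasoning
    G = (one ⊕ A ⊛ X) ⊛ I

  g-shift : ∀ n → g (suc n) ≈ - (p * g n) - r * κ n
  g-shift n = begin
    g (suc n)                                              ≈⟨ solve 3 (λ x y z → x := (x :+ y :+ z) :+ (:- y :- z)) refl _ _ _ ⟩
    g (suc n) + p * g n + r * κ n + (- (p * g n) - r * κ n)  ≈⟨ +-congʳ recurrence-at ⟩
    0# + (- (p * g n) - r * κ n)                           ≈⟨ +-identityˡ _ ⟩
    - (p * g n) - r * κ n                                  ∎
    where
    open ≈-Reasoning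
    recurrence-at : g (suc n) + p * g n + r * κ n ≈ 0#
    recurrence-at = trans (sym (+-cong (+-congˡ (const⊛X⊛-suc p g n)) (const⊛X⊛-suc r κ n))) (coeff g-recurrence (suc n))

  κ-shift : ∀ n → κ (suc n) ≈ g n - a * κ n
  κ-shift n = trans (X⊛-suc I n) (trans (solve 2 (λ i y → i := (i :+ y) :- y) refl (I n) (a * κ n))
                    (+-congʳ (sym (trans (coeff g≋I+Aκ n) (+-congˡ (const⊛ a κ n))))))

  ι! : ℕ → Carrier
  ι! n = invℕ ch (n !) {{n !≢0}}

  ℰ : Series → Series
  ℰ f n = f n * ι! n

  ι!-zero : ι! 0 ≈ 1#
  ι!-zero = sym (inverse-unique (ofℕ 1) 1# (ch 1) (trans (*-identityʳ _) (+-identityʳ 1#)))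

  ι!-suc : ∀ n → ofℕ (suc n) * ι! (suc n) ≈ ι! n
  ι!-suc n = inverse-unique (ofℕ (n !)) _ (ch (n !) {{n !≢0}}) (begin
    ofℕ (n !) * (ofℕ (suc n) * ι! (suc n))   ≈⟨ *-assoc _ _ _ ⟨
    (ofℕ (n !) * ofℕ (suc n)) * ι! (suc n)   ≈⟨ *-congʳ (trans (*-comm _ _) (sym (ofℕ-* (suc n) (n !)))) ⟩
    ofℕ (suc n !) * ι! (suc n)               ≈⟨ inverse _ _ ⟩
    1#                                       ∎)
    where open ≈-Reasoning

  𝔇-ℰ : ∀ f n → 𝔇 (ℰ f) n ≈ f (suc n) * ι! n
  𝔇-ℰ f n = trans (solve 3 (λ m x i → m :* (x :* i) := x :* (m :* i)) refl _ _ _) (*-congˡ (ι!-suc n))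

  Gₑ κₑ : Series
  Gₑ = geSeries ch a b c′
  κₑ = ℰ κ

  𝔇Gₑ : 𝔇 Gₑ ≋ negₛ (P ⊛ Gₑ) ⊖ R ⊛ κₑ
  𝔇Gₑ = mk≋ λ n → begin
    𝔇 (ℰ g) n                                      ≈⟨ 𝔇-ℰ g n ⟩
    g (suc n) * ι! n                               ≈⟨ *-congʳ (g-shift n) ⟩
    (- (p * g n) - r * κ n) * ι! n                 ≈⟨ solve 5 (λ p g r k i → (:- (p :* g) :- r :* k) :* i := :- (p :* (g :* i)) :- r :* (k :* i)) refl p (g n) r (κ n) (ι! n) ⟩
    - (p * (g n * ι! n)) - r * (κ n * ι! n)        ≈⟨ +-cong (-‿cong (const⊛ p Gₑ n)) (-‿cong (const⊛ r κₑ n)) ⟨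
    (negₛ (P ⊛ Gₑ) ⊖ R ⊛ κₑ) n                     ∎
    where open ≈-Reasoning

  𝔇κₑ : 𝔇 κₑ ≋ Gₑ ⊖ A ⊛ κₑ
  𝔇κₑ = mk≋ λ n → begin
    𝔇 (ℰ κ) n                        ≈⟨ 𝔇-ℰ κ n ⟩
    κ (suc n) * ι! n                 ≈⟨ *-congʳ (κ-shift n) ⟩
    (g n - a * κ n) * ι! n           ≈⟨ solve 4 (λ g a k i → (g :- a :* k) :* i := g :* i :- a :* (k :* i)) refl (g n) a (κ n) (ι! n) ⟩
    g n * ι! n - a * (κ n * ι! n)    ≈⟨ +-congˡ (-‿cong (const⊛ a κₑ n)) ⟨
    (Gₑ ⊖ A ⊛ κₑ) n                  ∎
    where open ≈-Reasoning

  U f : Series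
  U = inv1 Gₑ
  f = κₑ ⊛ U

  UGₑ≈1 : U ⊛ Gₑ ≋ one
  UGₑ≈1 = S.trans (S.*-comm U Gₑ) (inv1-inverse Gₑ (trans (*-cong g₀≈1 ι!-zero) (*-identityˡ 1#)))

  𝔇U : 𝔇 U ≋ (P ⊕ R ⊛ f) ⊛ U
  𝔇U = begin
    𝔇 U                                 ≈⟨ S.*-identityʳ (𝔇 U) ⟨
    𝔇 U ⊛ one                           ≈⟨ S.*-congˡ UGₑ≈1 ⟨
    𝔇 U ⊛ (U ⊛ Gₑ)                      ≈⟨ solveₛ 3 (λ V U G → V ⊠ (U ⊠ G) :=ₛ U ⊠ (V ⊠ G)) S.refl (𝔇 U) U Gₑ ⟩
    U ⊛ (𝔇 U ⊛ Gₑ)                      ≈⟨ S.*-congˡ 𝔇U⊛Gₑ ⟩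
    U ⊛ negₛ (U ⊛ 𝔇 Gₑ)                 ≈⟨ S.*-congˡ (S.-‿cong (S.*-congˡ 𝔇Gₑ)) ⟩
    U ⊛ negₛ (U ⊛ (negₛ (P ⊛ Gₑ) ⊖ R ⊛ κₑ))  ≈⟨ solveₛ 5 (λ U G K P R → U ⊠ (⊟ (U ⊠ (⊟ (P ⊠ G) ⊟ R ⊠ K))) :=ₛ (P ⊠ (U ⊠ G) ⊞ R ⊠ (K ⊠ U)) ⊠ U)
                                                S.refl U Gₑ κₑ P R ⟩
    (P ⊛ (U ⊛ Gₑ) ⊕ R ⊛ f) ⊛ U          ≈⟨ S.*-congʳ {U} (S.+-congʳ (S.trans (S.*-congˡ UGₑ≈1) (S.*-identityʳ P))) ⟩
    (P ⊕ R ⊛ f) ⊛ U                     ∎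
    where
    open ≋-Reasoning
    𝔇U⊛Gₑ : 𝔇 U ⊛ Gₑ ≋ negₛ (U ⊛ 𝔇 Gₑ)
    𝔇U⊛Gₑ = begin
      𝔇 U ⊛ Gₑ                                   ≈⟨ solveₛ 2 (λ X Y → X :=ₛ (X ⊞ Y) ⊟ Y) S.refl (𝔇 U ⊛ Gₑ) (U ⊛ 𝔇 Gₑ) ⟩
      (𝔇 U ⊛ Gₑ ⊕ U ⊛ 𝔇 Gₑ) ⊖ U ⊛ 𝔇 Gₑ           ≈⟨ S.+-congʳ (S.trans (S.sym (𝔇-Leibniz U Gₑ)) (S.trans (𝔇-cong UGₑ≈1) (𝔇-const 1#))) ⟩
      0ₛ ⊖ U ⊛ 𝔇 Gₑ                              ≈⟨ S.+-identityˡ (negₛ (U ⊛ 𝔇 Gₑ)) ⟩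
      negₛ (U ⊛ 𝔇 Gₑ)                            ∎

  𝔇f : 𝔇 f ≋ one ⊕ Q ⊛ f ⊕ R ⊛ (f ⊛ f)
  𝔇f = begin
    𝔇 (κₑ ⊛ U)                                  ≈⟨ 𝔇-Leibniz κₑ U ⟩
    𝔇 κₑ ⊛ U ⊕ κₑ ⊛ 𝔇 U                         ≈⟨ S.+-cong (S.*-congʳ {U} 𝔇κₑ) (S.*-congˡ 𝔇U) ⟩
    (Gₑ ⊖ A ⊛ κₑ) ⊛ U ⊕ κₑ ⊛ ((P ⊕ R ⊛ f) ⊛ U)  ≈⟨ solveₛ 6 (λ G A K U P R → (G ⊟ A ⊠ K) ⊠ U ⊞ K ⊠ ((P ⊞ R ⊠ (K ⊠ U)) ⊠ U)
                                                               :=ₛ U ⊠ G ⊞ (P ⊟ A) ⊠ (K ⊠ U) ⊞ R ⊠ ((K ⊠ U) ⊠ (K ⊠ U)))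
                                                     S.refl Gₑ A κₑ U P R ⟩
    U ⊛ Gₑ ⊕ (P ⊖ A) ⊛ f ⊕ R ⊛ (f ⊛ f)         ≈⟨ S.+-congʳ (S.+-cong UGₑ≈1 (S.*-congʳ {f} (S.sym Q≋P-A))) ⟩
    one ⊕ Q ⊛ f ⊕ R ⊛ (f ⊛ f)                   ∎
    where open ≋-Reasoning

  N : ℕ → Series
  N k = const (ofℕ k)

  𝔇-pow : ∀ k → 𝔇 (pow f (suc k)) ≋ N (suc k) ⊛ (pow f k ⊛ 𝔇 f)
  𝔇-pow zero = begin
    𝔇 (f ⊛ one)                      ≈⟨ 𝔇-Leibniz f one ⟩
    𝔇 f ⊛ one ⊕ f ⊛ 𝔇 one            ≈⟨ S.+-congˡ (S.*-congˡ (𝔇-const 1#)) ⟩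
    𝔇 f ⊛ one ⊕ f ⊛ 0ₛ               ≈⟨ solveₛ 2 (λ D F → D ⊠ conₛ (+ 1) ⊞ F ⊠ conₛ (+ 0) :=ₛ (conₛ (+ 1) ⊞ conₛ (+ 0)) ⊠ (conₛ (+ 1) ⊠ D)) S.refl (𝔇 f) f ⟩
    (one ⊕ 0ₛ) ⊛ (one ⊛ 𝔇 f)         ≈⟨ S.*-congʳ {one ⊛ 𝔇 f} (S.sym (S.trans (const-+ 1# 0#) (S.+-congˡ const-0≋0ₛ))) ⟩
    N 1 ⊛ (one ⊛ 𝔇 f)                ∎
    where open ≋-Reasoning
  𝔇-pow (suc k) = begin
    𝔇 (f ⊛ pow f (suc k))                       ≈⟨ 𝔇-Leibniz f (pow f (suc k)) ⟩
    𝔇 f ⊛ pow f (suc k) ⊕ f ⊛ 𝔇 (pow f (suc k))  ≈⟨ S.+-congˡ (S.*-congˡ (𝔇-pow k)) ⟩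
    𝔇 f ⊛ pow f (suc k) ⊕ f ⊛ (N (suc k) ⊛ (pow f k ⊛ 𝔇 f))
      ≈⟨ solveₛ 4 (λ D F P M → D ⊠ (F ⊠ P) ⊞ F ⊠ (M ⊠ (P ⊠ D)) :=ₛ (conₛ (+ 1) ⊞ M) ⊠ ((F ⊠ P) ⊠ D)) S.refl (𝔇 f) f (pow f k) (N (suc k)) ⟩
    (one ⊕ N (suc k)) ⊛ (pow f (suc k) ⊛ 𝔇 f)   ≈⟨ S.*-congʳ {pow f (suc k) ⊛ 𝔇 f} (S.sym (const-+ 1# (ofℕ (suc k)))) ⟩
    N (suc (suc k)) ⊛ (pow f (suc k) ⊛ 𝔇 f)     ∎
    where open ≋-Reasoning

  W : ℕ → Series
  W k = U ⊛ pow f k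

  γs δs : ℕ → Carrier
  γs k = ofℕ k
  δs k = r * ofℕ (suc k)

  const-αs : ∀ k → const (αs k) ≋ P ⊕ N k ⊛ Q
  const-αs k = S.trans (const-+ p _) (S.+-congˡ (const-* (ofℕ k) q))

  const-δs : ∀ k → const (δs k) ≋ R ⊛ N (suc k)
  const-δs k = const-* r _

  𝔇W-zero : 𝔇 (W 0) ≋ const (αs 0) ⊛ W 0 ⊕ const (δs 0) ⊛ W 1
  𝔇W-zero = begin
    𝔇 (U ⊛ one)                          ≈⟨ 𝔇-Leibniz U one ⟩
    𝔇 U ⊛ one ⊕ U ⊛ 𝔇 one                ≈⟨ S.+-cong (S.*-congʳ {one} 𝔇U) (S.*-congˡ (𝔇-const 1#)) ⟩
    ((P ⊕ R ⊛ f) ⊛ U) ⊛ one ⊕ U ⊛ 0ₛ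
      ≈⟨ solveₛ 5 (λ U F P Q R → ((P ⊞ R ⊠ F) ⊠ U) ⊠ conₛ (+ 1) ⊞ U ⊠ conₛ (+ 0)
                              :=ₛ (P ⊞ conₛ (+ 0) ⊠ Q) ⊠ (U ⊠ conₛ (+ 1)) ⊞ (R ⊠ (conₛ (+ 1) ⊞ conₛ (+ 0))) ⊠ (U ⊠ (F ⊠ conₛ (+ 1))))
                  S.refl U f P Q R ⟩
    (P ⊕ 0ₛ ⊛ Q) ⊛ W 0 ⊕ (R ⊛ (one ⊕ 0ₛ)) ⊛ W 1
      ≈⟨ S.+-cong (S.*-congʳ {W 0} (S.sym (S.trans (const-αs 0) (S.+-congˡ (S.*-congʳ {Q} const-0≋0ₛ)))))
                  (S.*-congʳ {W 1} (S.sym (S.trans (const-δs 0) (S.*-congˡ (S.trans (const-+ 1# 0#) (S.+-congˡ const-0≋0ₛ)))))) ⟩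
    const (αs 0) ⊛ W 0 ⊕ const (δs 0) ⊛ W 1  ∎
    where open ≋-Reasoning

  𝔇W-suc : ∀ k → 𝔇 (W (suc k)) ≋ const (γs (suc k)) ⊛ W k ⊕ const (αs (suc k)) ⊛ W (suc k) ⊕ const (δs (suc k)) ⊛ W (suc (suc k))
  𝔇W-suc k = begin
    𝔇 (U ⊛ pow f (suc k))
      ≈⟨ 𝔇-Leibniz U (pow f (suc k)) ⟩
    𝔇 U ⊛ pow f (suc k) ⊕ U ⊛ 𝔇 (pow f (suc k))
      ≈⟨ S.+-cong (S.*-congʳ {pow f (suc k)} 𝔇U) (S.*-congˡ (S.trans (𝔇-pow k) (S.*-congˡ (S.*-congˡ 𝔇f)))) ⟩
    ((P ⊕ R ⊛ f) ⊛ U) ⊛ pow f (suc k) ⊕ U ⊛ (N (suc k) ⊛ (pow f k ⊛ (one ⊕ Q ⊛ f ⊕ R ⊛ (f ⊛ f))))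
      ≈⟨ solveₛ 7 (λ U F Fᵏ P Q R M → ((P ⊞ R ⊠ F) ⊠ U) ⊠ (F ⊠ Fᵏ) ⊞ U ⊠ (M ⊠ (Fᵏ ⊠ (conₛ (+ 1) ⊞ Q ⊠ F ⊞ R ⊠ (F ⊠ F))))
                                   :=ₛ M ⊠ (U ⊠ Fᵏ) ⊞ (P ⊞ M ⊠ Q) ⊠ (U ⊠ (F ⊠ Fᵏ)) ⊞ (R ⊠ (conₛ (+ 1) ⊞ M)) ⊠ (U ⊠ (F ⊠ (F ⊠ Fᵏ))))
                  S.refl U f (pow f k) P Q R (N (suc k)) ⟩
    N (suc k) ⊛ W k ⊕ (P ⊕ N (suc k) ⊛ Q) ⊛ W (suc k) ⊕ (R ⊛ (one ⊕ N (suc k))) ⊛ W (suc (suc k))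
      ≈⟨ S.+-cong (S.+-congˡ (S.*-congʳ {W (suc k)} (S.sym (const-αs (suc k)))))
                  (S.*-congʳ {W (suc (suc k))} (S.sym (S.trans (const-δs (suc k)) (S.*-congˡ (const-+ 1# (ofℕ (suc k))))))) ⟩
    const (γs (suc k)) ⊛ W k ⊕ const (αs (suc k)) ⊛ W (suc k) ⊕ const (δs (suc k)) ⊛ W (suc (suc k))  ∎
    where open ≋-Reasoning

  -- The first column L n 0 is u_n.
  L : ℕ → ℕ → Carrier
  L n k = ofℕ (n !) * W k n

  L-suc : ∀ n k → L (suc n) k ≈ ofℕ (n !) * 𝔇 (W k) n
  L-suc n k = trans (*-congʳ (ofℕ-* (suc n) (n !))) (solve 3 (λ m f w → (m :* f) :* w := f :* (m :* w)) refl _ _ _)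

  F≈𝒥 : FSeries ch a b c′ ≈ₛ 𝒥 αs βs
  F≈𝒥 n = trans (*-congˡ (sym (coeff (S.*-identityʳ U) n)))
    (ProductionMatrix.first-column K αs βs γs δs βs≈γδ L L₀₀ L₀ₛ Lₛ₀ Lₛₛ n)
    where
    βs≈γδ : ∀ k → βs k ≈ γs (suc k) * δs k
    βs≈γδ k = trans (*-congˡ (ofℕ-* (suc k) (suc k))) (solve 2 (λ r m → r :* (m :* m) := m :* (r :* m)) refl r (ofℕ (suc k)))
    f₀≈0 : f 0 ≈ 0#
    f₀≈0 = trans (*-congʳ (trans (*-congʳ (zeroˡ _)) (zeroˡ _))) (zeroˡ _)
    L₀₀ : L 0 0 ≈ 1#
    L₀₀ = trans (*-cong (+-identityʳ 1#) (*-identityˡ 1#)) (*-identityˡ 1#)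
    L₀ₛ : ∀ k → L 0 (suc k) ≈ 0#
    L₀ₛ k = trans (*-congˡ (trans (*-congˡ (pow-vanishes f f₀≈0 (suc k) 0 (s≤s z≤n))) (zeroʳ _))) (zeroʳ _)
    Lₛ₀ : ∀ n → L (suc n) 0 ≈ αs 0 * L n 0 + δs 0 * L n 1
    Lₛ₀ n = trans (L-suc n 0) (trans
      (*-congˡ (trans (coeff 𝔇W-zero n) (+-cong (const⊛ (αs 0) (W 0) n) (const⊛ (δs 0) (W 1) n))))
      (solve 5 (λ m x u y v → m :* (x :* u :+ y :* v) := x :* (m :* u) :+ y :* (m :* v)) refl (ofℕ (n !)) (αs 0) (W 0 n) (δs 0) (W 1 n)))
    Lₛₛ : ∀ n k → L (suc n) (suc k) ≈ γs (suc k) * L n k + αs (suc k) * L n (suc k) + δs (suc k) * L n (suc (suc k))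
    Lₛₛ n k = trans (L-suc n (suc k)) (trans
      (*-congˡ (trans (coeff (𝔇W-suc k) n) (+-cong (+-cong (const⊛ (γs (suc k)) (W k) n) (const⊛ (αs (suc k)) (W (suc k)) n))
                                                   (const⊛ (δs (suc k)) (W (suc (suc k))) n))))
      (solve 7 (λ m x u y v z w → m :* (x :* u :+ y :* v :+ z :* w) := x :* (m :* u) :+ y :* (m :* v) :+ z :* (m :* w))
             refl (ofℕ (n !)) (γs (suc k)) (W k n) (αs (suc k)) (W (suc k) n) (δs (suc k)) (W (suc (suc k)) n)))

proposition1 : {c ℓ : Level} (K : Field c ℓ) →
    let open Field K using (Carrier) in
    let open FieldOps K in
    (ch : CharZero) (a b c' : Carrier) →
      Σ (ℕ → Carrier) (λ α → Σ (ℕ → Carrier) (λ β → FSeries ch a b c' ≈ₛ 𝒥 α β))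
      × ((α β : ℕ → Carrier) → FSeries ch a b c' ≈ₛ 𝒥 α β →
           IsRev (gSeries a b c') (𝕋 ch α β))
proposition1 K ch a b c' = (αs , βs , F≈𝒥) , λ α β F≈𝒥αβ →
    Composition.IsRev-cong K g (WeightedUniqueness.𝕋-cong K ch (λ n → trans (sym (F≈𝒥 n)) (F≈𝒥αβ n))) g-reverts-𝕋
  where
  open Field K using (sym; trans)
  open Example K ch a b c'
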